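{- Let $r\in\mathbb{N}$, $G=(g_1,\ldots,g_r)$ a system of polynomials with integer coefficients, $m_1,\ldots,m_r\in\mathbb{N}$, and $M\in\mathbb{N}$ a multiple of $\operatorname{lcm}[m_1,\ldots,m_r]$. Then \[ \frac{1}{\phi(M)}\sum_{\substack{k=1\\ \gcd(k,M)=1}}^{M}\gcd(g_1(k),m_1)\cdots\gcd(g_r(k),m_r) =\sum_{d_1\mid m_1,\ldots,d_r\mid m_r}\frac{\phi(d_1)\cdots\phi(d_r)}{\phi(\operatorname{lcm}[d_1,\ldots,d_r])}\,\eta_G(d_1,\ldots,d_r), \] and this, as a function of $(m_1,\ldots,m_r)\in\mathbb{N}^r$, is a positive-integer-valued multiplicative function.
   Context: $\mathbb{N}=\{1,2,\ldots\}$. $\phi$ is Euler's totient function. $\eta_G(d_1,\ldots,d_r)$ is the number of residues $x$ modulo $\operatorname{lcm}[d_1,\ldots,d_r]$ with $g_i(x)\equiv 0\pmod{d_i}$ and $\gcd(x,d_i)=1$ for all $1\le i\le r$. A function $h:\mathbb{N}^r\to\mathbb{C}$ is multiplicative if it is not identically zero and $h(m_1n_1,\ldots,m_rn_r)=h(m_1,\ldots,m_r)h(n_1,\ldots,n_r)$ whenever $\gcd(m_1\cdots m_r,n_1\cdots n_r)=1$. -}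

module Defs where

open import Data.Bool using (Bool; true; false; _∧_)
import Data.Bool
open import Data.Nat as ℕ using (ℕ; zero; suc; _≤_)
open import Data.Nat.GCD using (gcd)
open import Data.Nat.LCM using (lcm)
open import Data.Nat.Divisibility using (_∣_; _∣?_)
open import Data.Nat.Coprimality using (Coprime)
open import Data.Integer as ℤ using (ℤ; +_; ∣_∣)
open import Data.Rational as ℚ using (ℚ; 0ℚ)
open import Data.Fin using (Fin)
import Data.Fin as Fin
open import Data.List using (List; []; _∷_; map; filter; length; foldr; upTo; concatMap)
open import Relation.Nullary.Decidable using (⌊_⌋)
open import Relation.Nullary using (¬_)
open import Relation.Binary.PropositionalEquality using (_≡_)
open import Data.Product using (∃; _×_)

-- Polynomials with integer coefficients: coefficient list, constant term first.
Poly : Set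
Poly = List ℤ

eval : Poly → ℤ → ℤ
eval []       x = + 0
eval (c ∷ cs) x = c ℤ.+ x ℤ.* eval cs x

φ : ℕ → ℕ
φ n = length (filter (λ k → gcd k n ℕ.≟ 1) (map suc (upTo n)))

-- Divisors of n (positive d with d ∣ n, 1 ≤ d ≤ n); for n = 0 the list is empty,
-- but it is only used for n ≥ 1.
divisors : ℕ → List ℕ
divisors n = filter (λ d → d ∣? n) (map suc (upTo n))

prodFin : ∀ r → (Fin r → ℕ) → ℕ
prodFin zero    f = 1
prodFin (suc r) f = f Fin.zero ℕ.* prodFin r (λ i → f (Fin.suc i))

lcmFin : ∀ r → (Fin r → ℕ) → ℕ
lcmFin zero    f = 1
lcmFin (suc r) f = lcm (f Fin.zero) (lcmFin r (λ i → f (Fin.suc i)))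

allFin : ∀ r → (Fin r → Bool) → Bool
allFin zero    f = true
allFin (suc r) f = f Fin.zero ∧ allFin r (λ i → f (Fin.suc i))

consFin : ∀ {r} → ℕ → (Fin r → ℕ) → Fin (suc r) → ℕ
consFin d t Fin.zero    = d
consFin d t (Fin.suc i) = t i

divTuples : ∀ r → (Fin r → ℕ) → List (Fin r → ℕ)
divTuples zero    m = (λ ()) ∷ []
divTuples (suc r) m =
  concatMap (λ d → map (consFin d) (divTuples r (λ i → m (Fin.suc i))))
            (divisors (m Fin.zero))

toℚ : ℕ → ℚ
toℚ n = + n ℚ./ 1

sumℚ : List ℚ → ℚ
sumℚ = foldr ℚ._+_ 0ℚ

sumℕ : List ℕ → ℕ
sumℕ = foldr ℕ._+_ 0

-- q / n as a rational; division by 0 is set to 0 (never used: denominators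
-- are totients of positive integers, hence ≥ 1).
_÷ℕ_ : ℚ → ℕ → ℚ
q ÷ℕ zero    = 0ℚ
q ÷ℕ (suc n) = q ℚ.* (+ 1 ℚ./ suc n)

η : ∀ r → (Fin r → Poly) → (Fin r → ℕ) → ℕ
η r G d = length (filter (λ x → cond x Data.Bool.≟ true) (upTo (lcmFin r d)))
  where
  cond : ℕ → Bool
  cond x = allFin r (λ i → ⌊ d i ∣? ∣ eval (G i) (+ x) ∣ ⌋ ∧ ⌊ gcd x (d i) ℕ.≟ 1 ⌋)

LHS : ∀ r → (Fin r → Poly) → (Fin r → ℕ) → ℕ → ℚ
LHS r G m M =
  toℚ (sumℕ (map (λ k → prodFin r (λ i → gcd ∣ eval (G i) (+ k) ∣ (m i)))
                     (filter (λ k → gcd k M ℕ.≟ 1) (map suc (upTo M)))))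
  ÷ℕ φ M

RHS : ∀ r → (Fin r → Poly) → (Fin r → ℕ) → ℚ
RHS r G m =
  sumℚ (map (λ d → (toℚ (prodFin r (λ i → φ (d i))) ÷ℕ φ (lcmFin r d))
                     ℚ.* toℚ (η r G d))
            (divTuples r m))

Positive : ∀ r → (Fin r → ℕ) → Set
Positive r m = ∀ i → 1 ≤ m i

Multiplicative : ∀ r → ((Fin r → ℕ) → ℚ) → Set
Multiplicative r h =
  (∃ λ m → Positive r m × ¬ (h m ≡ 0ℚ)) ×
  (∀ m n → Positive r m → Positive r n →
     Coprime (prodFin r m) (prodFin r n) →
     h (λ i → m i ℕ.* n i) ≡ h m ℚ.* h n)

-- By Gauss, gcd(c, m) = ∑_{d ∣ m, d ∣ c} φ(d); expanding the product turns the
-- left sum into ∑_d Φ(d) · #{k < M a unit : dᵢ ∣ gᵢ(k) for all i}.  The key counting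
-- fact (uniformLift) is that for L ∣ M every unit class modulo L contains the same
-- number N = φ(M)/φ(L) of units modulo M; it is proved by strong induction on M/L
-- with the Chinese remainder theorem.  As dᵢ ∣ gᵢ(k) only depends on k modulo lcm d
-- (polynomial congruences), tuple d contributes φ(M) · Φ(d)/φ(lcm d) · η_G(d).  The
-- quotient Φ(d)/φ(lcm d) is an integer since φ(lcm a b) φ(gcd a b) = φ(a) φ(b),
-- again a consequence of uniformLift.  Multiplicativity comes from the CRT
-- factorisation of the sum over the units modulo lcm[m] · lcm[n].
module Submission where

open import Defs
open import Data.Bool using (Bool; true; false; _∧_)
import Data.Bool
open import Data.Empty using (⊥-elim)
open import Data.Fin using (Fin)
open import Data.Integer as ℤ using (ℤ; ∣_∣)
import Data.Integer.Properties as ℤ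
import Data.Integer.Divisibility.Signed as Signed
import Data.Integer.Tactic.RingSolver as ℤ-Solver
open import Data.Rational as ℚ using (ℚ; mkℚ; 0ℚ)
import Data.Rational.Properties as ℚ
import Data.Rational.Unnormalised as ℚᵘ
import Data.Rational.Unnormalised.Properties as ℚᵘ
import Data.Fin as Fin
open import Data.Nat
open import Data.Nat.Properties
open import Data.Nat.DivMod
open import Data.Nat.Divisibility
open import Data.Nat.GCD
open import Data.Nat.LCM
open import Data.Nat.Coprimality using (Coprime; coprime⇒gcd≡1; gcd≡1⇒coprime; coprime-divisor; 1-coprimeTo)
import Data.Nat.Coprimality as Coprime
open import Data.Nat.Induction using (<-rec)
open import Data.Nat.Tactic.RingSolver using (solve-∀)
open import Data.List using (List; []; _∷_; map; filter; length; upTo; applyUpTo; concatMap; _++_)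
open import Data.List.Properties using (map-upTo; map-cong)
open import Data.List.Relation.Unary.All as All using (All; []; _∷_)
import Data.List.Relation.Unary.All.Properties as All
open import Data.Product using (∃; _×_; _,_; proj₁; proj₂)
open import Data.Sum using (inj₁; inj₂)
open import Function using (_∘_; case_of_; _⇔_; mk⇔; Equivalence)
open import Relation.Binary.PropositionalEquality
open import Relation.Nullary using (¬_; Dec; yes; no; does)
open import Relation.Nullary.Decidable using (dec-true; dec-false; ⌊_⌋; isYes≗does; does-⇔)
open import Relation.Unary using (Pred; Decidable)
open import Level using (0ℓ)

∑< : ℕ → (ℕ → ℕ) → ℕ
∑< zero    f = 0
∑< (suc n) f = f 0 + ∑< n (λ k → f (suc k))

interchange : ∀ a b c d → a + b + (c + d) ≡ a + c + (b + d)
interchange = solve-∀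

*-interchange : ∀ a b c d → a * b * (c * d) ≡ a * c * (b * d)
*-interchange = solve-∀

∑<-cong : ∀ n {f g : ℕ → ℕ} → (∀ k → k < n → f k ≡ g k) → ∑< n f ≡ ∑< n g
∑<-cong zero    h = refl
∑<-cong (suc n) h = cong₂ _+_ (h 0 z<s) (∑<-cong n (λ k k<n → h (suc k) (s<s k<n)))

∑<-+ : ∀ n (f g : ℕ → ℕ) → ∑< n (λ k → f k + g k) ≡ ∑< n f + ∑< n g
∑<-+ zero    f g = refl
∑<-+ (suc n) f g = trans (cong (f 0 + g 0 +_) (∑<-+ n (λ k → f (suc k)) (λ k → g (suc k))))
                         (interchange (f 0) (g 0) _ _)

∑<-*ˡ : ∀ n c (f : ℕ → ℕ) → ∑< n (λ k → c * f k) ≡ c * ∑< n f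
∑<-*ˡ zero    c f = sym (*-zeroʳ c)
∑<-*ˡ (suc n) c f = trans (cong (c * f 0 +_) (∑<-*ˡ n c (λ k → f (suc k))))
                          (sym (*-distribˡ-+ c (f 0) _))

∑<-*ʳ : ∀ n c (f : ℕ → ℕ) → ∑< n (λ k → f k * c) ≡ ∑< n f * c
∑<-*ʳ n c f = trans (∑<-cong n (λ k _ → *-comm (f k) c)) (trans (∑<-*ˡ n c f) (*-comm c _))

∑<-split : ∀ m n (f : ℕ → ℕ) → ∑< (m + n) f ≡ ∑< m f + ∑< n (λ k → f (m + k))
∑<-split zero    n f = refl
∑<-split (suc m) n f = trans (cong (f 0 +_) (∑<-split m n (λ k → f (suc k)))) (sym (+-assoc (f 0) _ _))

∑<-const : ∀ n c → ∑< n (λ _ → c) ≡ n * c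
∑<-const zero    c = refl
∑<-const (suc n) c = cong (c +_) (∑<-const n c)

∑<-zero : ∀ n (f : ℕ → ℕ) → (∀ k → k < n → f k ≡ 0) → ∑< n f ≡ 0
∑<-zero n f h = trans (∑<-cong n h) (trans (∑<-const n 0) (*-zeroʳ n))

∑<-single : ∀ n (f : ℕ → ℕ) c → c < n → (∀ k → k < n → k ≢ c → f k ≡ 0) → ∑< n f ≡ f c
∑<-single (suc n) f zero    _ h =
  trans (cong (f 0 +_) (∑<-zero n _ (λ k k<n → h (suc k) (s<s k<n) (λ ())))) (+-identityʳ _)
∑<-single (suc n) f (suc c) c<n h = trans (cong (_+ ∑< n (λ k → f (suc k))) (h 0 z<s (λ ())))
  (∑<-single n (λ k → f (suc k)) c (s<s⁻¹ c<n) (λ k k<n k≢c → h (suc k) (s<s k<n) (k≢c ∘ suc-injective)))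

∑<-swap : ∀ n m (F : ℕ → ℕ → ℕ) → ∑< n (λ i → ∑< m (F i)) ≡ ∑< m (λ j → ∑< n (λ i → F i j))
∑<-swap zero    m F = sym (∑<-zero m _ (λ _ _ → refl))
∑<-swap (suc n) m F = trans (cong (∑< m (F 0) +_) (∑<-swap n m (λ i → F (suc i))))
                            (sym (∑<-+ m (F 0) (λ j → ∑< n (λ i → F (suc i) j))))

∑<-mono : ∀ n (f g : ℕ → ℕ) → (∀ k → k < n → f k ≤ g k) → ∑< n f ≤ ∑< n g
∑<-mono zero    f g h = z≤n
∑<-mono (suc n) f g h = +-mono-≤ (h 0 z<s) (∑<-mono n _ _ (λ k k<n → h (suc k) (s<s k<n)))

∑<-shift : ∀ n (f : ℕ → ℕ) → f n ≡ f 0 → ∑< n (λ k → f (suc k)) ≡ ∑< n f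
∑<-shift n f fn≡f0 = +-cancelˡ-≡ (f 0) _ _ (begin
  ∑< (suc n) f                 ≡⟨ cong (λ x → ∑< x f) (+-comm 1 n) ⟩
  ∑< (n + 1) f                 ≡⟨ ∑<-split n 1 f ⟩
  ∑< n f + (f (n + 0) + 0)     ≡⟨ cong (λ x → ∑< n f + (f x + 0)) (+-identityʳ n) ⟩
  ∑< n f + (f n + 0)           ≡⟨ cong (∑< n f +_) (trans (+-identityʳ _) fn≡f0) ⟩
  ∑< n f + f 0                 ≡⟨ +-comm (∑< n f) (f 0) ⟩
  f 0 + ∑< n f                 ∎)
  where open ≡-Reasoning

∑<-periods : ∀ q L (P : ℕ → ℕ) → (∀ k → P (L + k) ≡ P k) → ∑< (q * L) P ≡ q * ∑< L P
∑<-periods zero    L P per = refl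
∑<-periods (suc q) L P per = begin
  ∑< (L + q * L) P                      ≡⟨ ∑<-split L (q * L) P ⟩
  ∑< L P + ∑< (q * L) (λ k → P (L + k)) ≡⟨ cong (∑< L P +_) (∑<-cong (q * L) (λ k _ → per k)) ⟩
  ∑< L P + ∑< (q * L) P                 ≡⟨ cong (∑< L P +_) (∑<-periods q L P per) ⟩
  ∑< L P + q * ∑< L P                   ∎
  where open ≡-Reasoning

∑<-pairs : ∀ A B .{{_ : NonZero B}} (f h : ℕ → ℕ) →
  ∑< (A * B) (λ z → f (z / B) * h (z % B)) ≡ ∑< A f * ∑< B h
∑<-pairs zero    B f h = refl
∑<-pairs (suc A) B f h = begin
  ∑< (B + A * B) w
    ≡⟨ ∑<-split B (A * B) w ⟩
  ∑< B w + ∑< (A * B) (λ z → w (B + z))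
    ≡⟨ cong₂ _+_ (∑<-cong B firstBlock) (∑<-cong (A * B) (λ z _ → laterBlock z)) ⟩
  ∑< B (λ z → f 0 * h z) + ∑< (A * B) (λ z → f (suc (z / B)) * h (z % B))
    ≡⟨ cong₂ _+_ (∑<-*ˡ B (f 0) h) (∑<-pairs A B (λ a → f (suc a)) h) ⟩
  f 0 * ∑< B h + ∑< A (λ a → f (suc a)) * ∑< B h
    ≡⟨ sym (*-distribʳ-+ (∑< B h) (f 0) _) ⟩
  ∑< (suc A) f * ∑< B h ∎
  where
  open ≡-Reasoning
  w : ℕ → ℕ
  w z = f (z / B) * h (z % B)
  firstBlock : ∀ z → z < B → w z ≡ f 0 * h z
  firstBlock z z<B = cong₂ (λ a b → f a * h b) (m<n⇒m/n≡0 z<B) (m<n⇒m%n≡m z<B)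
  laterBlock : ∀ z → w (B + z) ≡ f (suc (z / B)) * h (z % B)
  laterBlock z = cong₂ (λ a b → f a * h b)
    (trans (m/n≡1+[m∸n]/n (m≤m+n B z)) (cong (λ x → suc (x / B)) (m+n∸m≡n B z)))
    (trans (cong (_% B) (+-comm B z)) ([m+n]%n≡m%n z B))

𝟙 : Bool → ℕ
𝟙 true  = 1
𝟙 false = 0

𝟙-∧ : ∀ x y → 𝟙 (x ∧ y) ≡ 𝟙 x * 𝟙 y
𝟙-∧ true  y = sym (+-identityʳ (𝟙 y))
𝟙-∧ false y = refl

∧-true : ∀ {x y} → x ∧ y ≡ true → x ≡ true × y ≡ true
∧-true {true} {true} _ = refl , refl

𝟙-yes : ∀ {A : Set} (a? : Dec A) → A → 𝟙 (does a?) ≡ 1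
𝟙-yes a? a = cong 𝟙 (dec-true a? a)

𝟙-no : ∀ {A : Set} (a? : Dec A) → ¬ A → 𝟙 (does a?) ≡ 0
𝟙-no a? ¬a = cong 𝟙 (dec-false a? ¬a)

true⇒ : ∀ {A : Set} (a? : Dec A) → does a? ≡ true → A
true⇒ (yes a) _ = a

-- Proof by double counting  𝟙 (p k) · [π k ≡ x] · w x  over pairs (k, x).
∑<-reindex : ∀ n m (p q : ℕ → Bool) (w π : ℕ → ℕ) →
  (∀ k → k < n → p k ≡ true → π k < m × q (π k) ≡ true) →
  (∀ k k' → k < n → k' < n → p k ≡ true → p k' ≡ true → π k ≡ π k' → k ≡ k') →
  (∀ x → x < m → q x ≡ true → ∃ λ k → k < n × p k ≡ true × π k ≡ x) →
  ∑< n (λ k → 𝟙 (p k) * w (π k)) ≡ ∑< m (λ x → 𝟙 (q x) * w x)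
∑<-reindex n m p q w π into injective onto = begin
  ∑< n (λ k → 𝟙 (p k) * w (π k))                 ≡⟨ ∑<-cong n (λ k k<n → sym (expandTerm k k<n)) ⟩
  ∑< n (λ k → ∑< m (λ x → hit k x * w x))         ≡⟨ ∑<-swap n m (λ k x → hit k x * w x) ⟩
  ∑< m (λ x → ∑< n (λ k → hit k x * w x))         ≡⟨ ∑<-cong m (λ x _ → ∑<-*ʳ n (w x) (λ k → hit k x)) ⟩
  ∑< m (λ x → ∑< n (λ k → hit k x) * w x)         ≡⟨ ∑<-cong m (λ x x<m → cong (_* w x) (preimages x x<m)) ⟩
  ∑< m (λ x → 𝟙 (q x) * w x)                      ∎
  where
  open ≡-Reasoning
  hit : ℕ → ℕ → ℕ
  hit k x = 𝟙 (p k) * 𝟙 (does (π k ≟ x))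
  miss : ∀ k x → (p k ≡ true → π k ≢ x) → hit k x ≡ 0
  miss k x h with p k in pk
  ... | false = refl
  ... | true  = cong (1 *_) (𝟙-no (π k ≟ x) (h refl))
  hitSelf : ∀ k → p k ≡ true → hit k (π k) ≡ 1
  hitSelf k pk rewrite pk = cong (1 *_) (𝟙-yes (π k ≟ π k) refl)
  expandTerm : ∀ k → k < n → ∑< m (λ x → hit k x * w x) ≡ 𝟙 (p k) * w (π k)
  expandTerm k k<n = byCase (p k) refl
    where
    byCase : ∀ b → p k ≡ b → ∑< m (λ x → hit k x * w x) ≡ 𝟙 (p k) * w (π k)
    byCase false pk = trans (∑<-zero m _ (λ x _ → cong (_* w x) (miss k x (λ pk′ → case trans (sym pk) pk′ of λ ()))))
                            (cong (λ b → 𝟙 b * w (π k)) (sym pk))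
    byCase true  pk = begin
      ∑< m (λ x → hit k x * w x)
        ≡⟨ ∑<-single m _ (π k) (proj₁ (into k k<n pk)) (λ x _ x≢πk → cong (_* w x) (miss k x (λ _ e → x≢πk (sym e)))) ⟩
      hit k (π k) * w (π k)
        ≡⟨ cong (_* w (π k)) (hitSelf k pk) ⟩
      1 * w (π k)
        ≡⟨ cong (λ b → 𝟙 b * w (π k)) (sym pk) ⟩
      𝟙 (p k) * w (π k) ∎
  preimages : ∀ x → x < m → ∑< n (λ k → hit k x) ≡ 𝟙 (q x)
  preimages x x<m with q x in qx
  ... | false = ∑<-zero n _ (λ k k<n → miss k x (λ pk e →
                  case trans (sym qx) (trans (cong q (sym e)) (proj₂ (into k k<n pk))) of λ ()))
  ... | true with onto x x<m qx
  ... | k₀ , k₀<n , pk₀ , πk₀ = trans (∑<-single n _ k₀ k₀<n others) (subst (λ y → hit k₀ y ≡ 1) πk₀ (hitSelf k₀ pk₀))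
    where
    others : ∀ k → k < n → k ≢ k₀ → hit k x ≡ 0
    others k k<n k≢k₀ = miss k x (λ pk e → k≢k₀ (injective k k₀ k<n k₀<n pk pk₀ (trans e (sym πk₀))))

%≡⇒∣∸ : ∀ {x y} n .{{_ : NonZero n}} → x ≤ y → x % n ≡ y % n → n ∣ y ∸ x
%≡⇒∣∸ {x} {y} n x≤y e = divides (y / n ∸ x / n) (begin
  y ∸ x                                      ≡⟨ cong₂ _∸_ (m≡m%n+[m/n]*n y n) (m≡m%n+[m/n]*n x n) ⟩
  (y % n + y / n * n) ∸ (x % n + x / n * n)  ≡⟨ cong (λ z → (y % n + y / n * n) ∸ (z + x / n * n)) e ⟩
  (y % n + y / n * n) ∸ (y % n + x / n * n)  ≡⟨ [m+n]∸[m+o]≡n∸o (y % n) _ _ ⟩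
  y / n * n ∸ x / n * n                      ≡⟨ sym (*-distribʳ-∸ n (y / n) (x / n)) ⟩
  (y / n ∸ x / n) * n                        ∎)
  where open ≡-Reasoning

gcd-nonZero : ∀ a b .{{_ : NonZero a}} → NonZero (gcd a b)
gcd-nonZero a b = ≢-nonZero (gcd[m,n]≢0 a b (inj₁ (≢-nonZero⁻¹ a)))

lcm-nonZero : ∀ a b .{{_ : NonZero a}} .{{_ : NonZero b}} → NonZero (lcm a b)
lcm-nonZero a b = ≢-nonZero λ l≡0 → ≢-nonZero⁻¹ (a * b) {{m*n≢0 a b}}
  (trans (sym (gcd*lcm a b)) (trans (cong (gcd a b *_) l≡0) (*-zeroʳ (gcd a b))))

crt-unique-≤ : ∀ a b .{{_ : NonZero a}} .{{_ : NonZero b}} {x y} → x ≤ y → y < lcm a b →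
  x % a ≡ y % a → x % b ≡ y % b → x ≡ y
crt-unique-≤ a b {x} {y} x≤y y<l ea eb = sym (trans (sym (m+[n∸m]≡n x≤y)) (trans (cong (x +_) y∸x≡0) (+-identityʳ x)))
  where
  l∣y∸x : lcm a b ∣ y ∸ x
  l∣y∸x = lcm-least (%≡⇒∣∸ a x≤y ea) (%≡⇒∣∸ b x≤y eb)
  y∸x≡0 : y ∸ x ≡ 0
  y∸x≡0 with y ∸ x in d
  ... | zero  = refl
  ... | suc _ = ⊥-elim (<⇒≱ (≤-<-trans (≤-trans (≤-reflexive (sym d)) (m∸n≤m y x)) y<l)
                            (∣⇒≤ (subst (lcm a b ∣_) d l∣y∸x)))

crt-unique : ∀ a b .{{_ : NonZero a}} .{{_ : NonZero b}} {k k′} → k < lcm a b → k′ < lcm a b →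
  k % a ≡ k′ % a → k % b ≡ k′ % b → k ≡ k′
crt-unique a b {k} {k′} k< k′< ea eb with ≤-total k k′
... | inj₁ k≤k′ = crt-unique-≤ a b k≤k′ k′< ea eb
... | inj₂ k′≤k = sym (crt-unique-≤ a b k′≤k k< (sym ea) (sym eb))

-- Core of the existence part: from a Bézout relation g + v·b = u·a with g ∣ b,
-- two residues agreeing modulo g are glued into a common solution.
crt-glue : ∀ a b g u v x y .{{_ : NonZero a}} .{{_ : NonZero b}} .{{_ : NonZero g}} →
  g ∣ b → g + v * b ≡ u * a → x % g ≡ y % g →
  ∃ λ k → k % a ≡ x % a × k % b ≡ y % b
crt-glue a b g u v x y g∣b bézout x≡y = k , [m+kn]%n≡m%n x (t * u) a , k%b
  where
  -- shift y by a multiple of b so that it exceeds x; then g ∣ y′ ∸ x = t·g.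
  y′ : ℕ
  y′ = y + x * b
  x≤y′ : x ≤ y′
  x≤y′ = ≤-trans (m≤m*n x b) (m≤n+m (x * b) y)
  g∣y′∸x : g ∣ y′ ∸ x
  g∣y′∸x = %≡⇒∣∸ g x≤y′ (trans x≡y (sym (%-remove-+ʳ y (∣n⇒∣m*n x g∣b))))
  t : ℕ
  t = quotient g∣y′∸x
  k : ℕ
  k = x + t * u * a
  k≡ : k ≡ y′ + t * v * b
  k≡ = begin
    x + t * u * a           ≡⟨ cong (x +_) (*-assoc t u a) ⟩
    x + t * (u * a)         ≡⟨ cong (λ z → x + t * z) (sym bézout) ⟩
    x + t * (g + v * b)     ≡⟨ cong (x +_) (*-distribˡ-+ t g (v * b)) ⟩
    x + (t * g + t * (v * b)) ≡⟨ sym (+-assoc x _ _) ⟩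
    x + t * g + t * (v * b) ≡⟨ cong (λ z → x + z + t * (v * b)) (sym (_∣_.equality g∣y′∸x)) ⟩
    x + (y′ ∸ x) + t * (v * b) ≡⟨ cong₂ _+_ (m+[n∸m]≡n x≤y′) (sym (*-assoc t v b)) ⟩
    y′ + t * v * b          ∎
    where open ≡-Reasoning
  k%b : k % b ≡ y % b
  k%b = trans (cong (_% b) k≡) (trans ([m+kn]%n≡m%n y′ (t * v) b) ([m+kn]%n≡m%n y x b))

crt-exists : ∀ a b .{{_ : NonZero a}} .{{_ : NonZero b}} x y →
  (x % gcd a b) {{gcd-nonZero a b}} ≡ (y % gcd a b) {{gcd-nonZero a b}} →
  ∃ λ k → k < lcm a b × k % a ≡ x % a × k % b ≡ y % b
crt-exists a b x y x≡y = reduce (glue (Bézout.identity (gcd-GCD a b)))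
  where
  instance
    g≢0 : NonZero (gcd a b)
    g≢0 = gcd-nonZero a b
    l≢0 : NonZero (lcm a b)
    l≢0 = lcm-nonZero a b
  glue : Bézout.Identity (gcd a b) a b → ∃ λ k → k % a ≡ x % a × k % b ≡ y % b
  glue (Bézout.+- u v eq) = crt-glue a b (gcd a b) u v x y (gcd[m,n]∣n a b) eq x≡y
  glue (Bézout.-+ u v eq) with crt-glue b a (gcd a b) v u y x (gcd[m,n]∣m a b) eq (sym x≡y)
  ... | k , k%b , k%a = k , k%a , k%b
  reduce : (∃ λ k → k % a ≡ x % a × k % b ≡ y % b) → ∃ λ k → k < lcm a b × k % a ≡ x % a × k % b ≡ y % b
  reduce (k , k%a , k%b) = k % lcm a b , m%n<n k (lcm a b) ,
    trans (m∣n⇒o%n%m≡o%m a (lcm a b) k (m∣lcm[m,n] a b)) k%a ,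
    trans (m∣n⇒o%n%m≡o%m b (lcm a b) k (n∣lcm[m,n] a b)) k%b

-- Coprimality facts, phrased with gcd ≡ 1 as in the definitions of φ and η.
gcd-% : ∀ k n .{{_ : NonZero n}} → gcd (k % n) n ≡ gcd k n
gcd-% k n = GCD.unique (gcd-GCD (k % n) n)
  (GCD.is (%-presˡ-∣ (gcd[m,n]∣m k n) (gcd[m,n]∣n k n) , gcd[m,n]∣n k n)
          (λ { (d∣k%n , d∣n) → gcd-greatest (∣n∣m%n⇒∣m d∣n d∣k%n) d∣n }))

gcd-self : ∀ n → gcd n n ≡ n
gcd-self n = GCD.unique (gcd-GCD n n) GCD.refl

coprime-∣ : ∀ k {n e} → e ∣ n → gcd k n ≡ 1 → gcd k e ≡ 1
coprime-∣ k {n} {e} e∣n k⊥n = coprime⇒gcd≡1 {k} {e} λ { (d∣k , d∣e) → gcd≡1⇒coprime {k} {n} k⊥n (d∣k , ∣-trans d∣e e∣n) }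

coprime-* : ∀ k {a b} → gcd k a ≡ 1 → gcd k b ≡ 1 → gcd k (a * b) ≡ 1
coprime-* k {a} {b} k⊥a k⊥b = coprime⇒gcd≡1 {k} {a * b} λ { {d} (d∣k , d∣ab) →
  gcd≡1⇒coprime {k} {b} k⊥b (d∣k , coprime-divisor (d⊥a d∣k) d∣ab) }
  where
  d⊥a : ∀ {d} → d ∣ k → Coprime d a
  d⊥a d∣k (i∣d , i∣a) = gcd≡1⇒coprime {k} {a} k⊥a (∣-trans i∣d d∣k , i∣a)

coprime-∣∣ : ∀ {a a′ b b′} → a′ ∣ a → b′ ∣ b → gcd a b ≡ 1 → gcd a′ b′ ≡ 1
coprime-∣∣ {a} {a′} {b} {b′} a′∣a b′∣b a⊥b =
  trans (gcd-comm a′ b′) (coprime-∣ b′ a′∣a (trans (gcd-comm b′ a) (coprime-∣ a b′∣b a⊥b)))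

gcd-multiplicative : ∀ c m n → gcd m n ≡ 1 → gcd c (m * n) ≡ gcd c m * gcd c n
gcd-multiplicative c m n m⊥n = ∣-antisym D∣d₁d₂ d₁d₂∣D
  where
  d₁ : ℕ
  d₁ = gcd c m
  d₂ : ℕ
  d₂ = gcd c n
  D : ℕ
  D = gcd c (m * n)
  -- D ∣ gcd (c d₂) (m d₂) = d₁ d₂, since D ∣ m d₂ = gcd (m c) (m n).
  D∣d₁d₂ : D ∣ d₁ * d₂
  D∣d₁d₂ = subst (D ∣_) scaled (gcd-greatest (∣m⇒∣m*n d₂ (gcd[m,n]∣m c (m * n))) D∣md₂)
    where
    scaled : gcd (c * d₂) (m * d₂) ≡ d₁ * d₂
    scaled = trans (cong₂ gcd (*-comm c d₂) (*-comm m d₂)) (trans (sym (c*gcd[m,n]≡gcd[cm,cn] d₂ c m)) (*-comm d₂ d₁))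
    D∣md₂ : D ∣ m * d₂
    D∣md₂ = subst (D ∣_) (sym (c*gcd[m,n]≡gcd[cm,cn] m c n))
      (gcd-greatest (∣n⇒∣m*n m (gcd[m,n]∣m c (m * n))) (gcd[m,n]∣n c (m * n)))
  -- d₁ d₂ ∣ c because d₂ ∣ c = d₁ q and d₂ is coprime to d₁.
  d₁d₂∣D : d₁ * d₂ ∣ D
  d₁d₂∣D = gcd-greatest d₁d₂∣c (*-pres-∣ (gcd[m,n]∣n c m) (gcd[m,n]∣n c n))
    where
    c≡d₁q : c ≡ d₁ * quotient (gcd[m,n]∣m c m)
    c≡d₁q = m∣n⇒n≡m*quotient (gcd[m,n]∣m c m)
    d₂⊥d₁ : Coprime d₂ d₁
    d₂⊥d₁ (i∣d₂ , i∣d₁) = gcd≡1⇒coprime {m} {n} m⊥n (∣-trans i∣d₁ (gcd[m,n]∣n c m) , ∣-trans i∣d₂ (gcd[m,n]∣n c n))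
    d₁d₂∣c : d₁ * d₂ ∣ c
    d₁d₂∣c = subst (d₁ * d₂ ∣_) (sym c≡d₁q)
      (*-monoʳ-∣ d₁ (coprime-divisor d₂⊥d₁ (subst (d₂ ∣_) c≡d₁q (gcd[m,n]∣m c n))))

unit : ℕ → ℕ → ℕ
unit n k = 𝟙 (does (gcd k n ≟ 1))

unit-yes : ∀ n k → gcd k n ≡ 1 → unit n k ≡ 1
unit-yes n k = 𝟙-yes (gcd k n ≟ 1)

unit-no : ∀ n k → gcd k n ≢ 1 → unit n k ≡ 0
unit-no n k = 𝟙-no (gcd k n ≟ 1)

unit-cong : ∀ n k k′ → gcd k n ≡ gcd k′ n → unit n k ≡ unit n k′
unit-cong n k k′ e = cong (λ g → 𝟙 (does (g ≟ 1))) e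

unit-% : ∀ n k .{{_ : NonZero n}} → unit n (k % n) ≡ unit n k
unit-% n k = unit-cong n (k % n) k (gcd-% k n)

unit-* : ∀ a b k → unit (a * b) k ≡ unit a k * unit b k
unit-* a b k = byCases (gcd k a ≟ 1) (gcd k b ≟ 1)
  where
  byCases : Dec (gcd k a ≡ 1) → Dec (gcd k b ≡ 1) → unit (a * b) k ≡ unit a k * unit b k
  byCases (yes k⊥a) (yes k⊥b) rewrite unit-yes a k k⊥a | unit-yes b k k⊥b =
    unit-yes (a * b) k (coprime-* k k⊥a k⊥b)
  byCases (no ¬k⊥a) _ rewrite unit-no a k ¬k⊥a =
    unit-no (a * b) k (¬k⊥a ∘ coprime-∣ k (m∣m*n b))
  byCases (yes _) (no ¬k⊥b) rewrite unit-no b k ¬k⊥b | *-zeroʳ (unit a k) =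
    unit-no (a * b) k (¬k⊥b ∘ coprime-∣ k (n∣m*n a))

unit-∣ : ∀ {e n} k → e ∣ n → unit n k ≡ unit n k * unit e k
unit-∣ {e} {n} k e∣n = byCases (gcd k n ≟ 1)
  where
  byCases : Dec (gcd k n ≡ 1) → unit n k ≡ unit n k * unit e k
  byCases (no ¬k⊥n) rewrite unit-no n k ¬k⊥n = refl
  byCases (yes k⊥n) rewrite unit-yes n k k⊥n | unit-yes e k (coprime-∣ k e∣n k⊥n) = refl

digit-% : ∀ B .{{_ : NonZero B}} a b → b < B → (a * B + b) % B ≡ b
digit-% B a b b<B = trans (cong (_% B) (+-comm (a * B) b)) (trans ([m+kn]%n≡m%n b a B) (m<n⇒m%n≡m b<B))

digit-/ : ∀ B .{{_ : NonZero B}} a b → b < B → (a * B + b) / B ≡ a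
digit-/ B a b b<B = begin
  (a * B + b) / B   ≡⟨ +-distrib-/-∣ˡ b (n∣m*n a) ⟩
  a * B / B + b / B ≡⟨ cong₂ _+_ (m*n/n≡m a B) (m<n⇒m/n≡0 b<B) ⟩
  a + 0             ≡⟨ +-identityʳ a ⟩
  a                 ∎
  where open ≡-Reasoning

lcm-coprime : ∀ A B → gcd A B ≡ 1 → lcm A B ≡ A * B
lcm-coprime A B A⊥B = trans (sym (*-identityˡ (lcm A B))) (trans (cong (_* lcm A B) (sym A⊥B)) (gcd*lcm A B))

%1≡0 : ∀ n .{{_ : NonZero n}} x → n ≡ 1 → x % n ≡ 0
%1≡0 .1 x refl = n%1≡0 x

Periodic : (L : ℕ) .{{_ : NonZero L}} → (ℕ → ℕ) → Set
Periodic L P = ∀ k → P (k % L) ≡ P k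

-- For coprime A and B, the sum over [0, AB) of an A-periodic function times a
-- B-periodic function factors: k ↦ (k % A, k % B) is a bijection (CRT), realised
-- as the reindexing k ↦ (k % A) · B + k % B of [0, AB) onto itself.
∑<-crt : ∀ A B .{{_ : NonZero A}} .{{_ : NonZero B}} → gcd A B ≡ 1 → (f h : ℕ → ℕ) →
  Periodic A f → Periodic B h →
  ∑< (A * B) (λ k → f k * h k) ≡ ∑< A f * ∑< B h
∑<-crt A B A⊥B f h f-per h-per = begin
  ∑< (A * B) (λ k → f k * h k)       ≡⟨ ∑<-cong (A * B) (λ k _ → sym (throughDigits k)) ⟩
  ∑< (A * B) (λ k → 𝟙 true * w (π k)) ≡⟨ ∑<-reindex (A * B) (A * B) _ _ w π into injective onto ⟩
  ∑< (A * B) (λ x → 𝟙 true * w x)     ≡⟨ ∑<-cong (A * B) (λ x _ → +-identityʳ (w x)) ⟩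
  ∑< (A * B) w                        ≡⟨ ∑<-pairs A B f h ⟩
  ∑< A f * ∑< B h                     ∎
  where
  open ≡-Reasoning
  w : ℕ → ℕ
  w z = f (z / B) * h (z % B)
  π : ℕ → ℕ
  π k = (k % A) * B + k % B
  π/B : ∀ k → π k / B ≡ k % A
  π/B k = digit-/ B (k % A) (k % B) (m%n<n k B)
  π%B : ∀ k → π k % B ≡ k % B
  π%B k = digit-% B (k % A) (k % B) (m%n<n k B)
  throughDigits : ∀ k → 𝟙 true * w (π k) ≡ f k * h k
  throughDigits k = trans (+-identityʳ _)
    (cong₂ _*_ (trans (cong f (π/B k)) (f-per k)) (trans (cong h (π%B k)) (h-per k)))
  l≡AB : lcm A B ≡ A * B
  l≡AB = lcm-coprime A B A⊥B
  into : ∀ k → k < A * B → true ≡ true → π k < A * B × true ≡ true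
  into k _ _ = ≤-trans (+-monoʳ-< ((k % A) * B) (m%n<n k B))
                       (subst (_≤ A * B) (+-comm B ((k % A) * B)) (*-monoˡ-≤ B (m%n<n k A))) , refl
  injective : ∀ k k′ → k < A * B → k′ < A * B → true ≡ true → true ≡ true → π k ≡ π k′ → k ≡ k′
  injective k k′ k< k′< _ _ e = crt-unique A B (subst (k <_) (sym l≡AB) k<) (subst (k′ <_) (sym l≡AB) k′<)
    (trans (sym (π/B k)) (trans (cong (_/ B) e) (π/B k′)))
    (trans (sym (π%B k)) (trans (cong (_% B) e) (π%B k′)))
  onto : ∀ x → x < A * B → true ≡ true → ∃ λ k → k < A * B × true ≡ true × π k ≡ x
  compatible : ∀ x y → (x % gcd A B) {{gcd-nonZero A B}} ≡ (y % gcd A B) {{gcd-nonZero A B}}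
  compatible x y = trans (%1≡0 (gcd A B) {{gcd-nonZero A B}} x A⊥B) (sym (%1≡0 (gcd A B) {{gcd-nonZero A B}} y A⊥B))
  onto x x< _ with crt-exists A B (x / B) (x % B) (compatible (x / B) (x % B))
  ... | k , k<l , k%A , k%B = k , subst (k <_) l≡AB k<l , refl , (begin
    (k % A) * B + k % B
      ≡⟨ cong₂ (λ a b → a * B + b) (trans k%A (m<n⇒m%n≡m (m<n*o⇒m/o<n x<))) (trans k%B (m%n%n≡m%n x B)) ⟩
    (x / B) * B + x % B
      ≡⟨ +-comm _ (x % B) ⟩
    x % B + (x / B) * B
      ≡⟨ sym (m≡m%n+[m/n]*n x B) ⟩
    x ∎)

OnUnits : ℕ → (ℕ → ℕ) → Set
OnUnits L P = ∀ k → gcd k L ≢ 1 → P k ≡ 0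

unit-OnUnits : ∀ L P → OnUnits L P → ∀ k → unit L k * P k ≡ P k
unit-OnUnits L P onUnits k = byCases (gcd k L ≟ 1)
  where
  byCases : Dec (gcd k L ≡ 1) → unit L k * P k ≡ P k
  byCases (yes k⊥L) rewrite unit-yes L k k⊥L = +-identityʳ (P k)
  byCases (no ¬k⊥L) rewrite unit-no L k ¬k⊥L | onUnits k ¬k⊥L = refl

-- Lifting from modulus L to L·t: there is one multiplicity N such that every unit
-- class modulo L contains exactly N units modulo L·t, i.e. for all P as above
--   ∑_{k < Lt, gcd(k, Lt) = 1} P k = N · ∑_{k < L} P k.
UniformLift : (L : ℕ) .{{_ : NonZero L}} → ℕ → Set
UniformLift L t = ∃ λ N → ∀ P → Periodic L P → OnUnits L P →
  ∑< (L * t) (λ k → unit (L * t) k * P k) ≡ N * ∑< L P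

-- When gcd L t = 1 the lift is a CRT product, with N the number of units mod t.
uniformLift-coprime : ∀ L t .{{_ : NonZero L}} .{{_ : NonZero t}} → gcd L t ≡ 1 → UniformLift L t
uniformLift-coprime L t L⊥t = ∑< t (unit t) , λ P per onUnits → begin
  ∑< (L * t) (λ k → unit (L * t) k * P k) ≡⟨ ∑<-cong (L * t) (λ k _ → rearrange P onUnits k) ⟩
  ∑< (L * t) (λ k → P k * unit t k)       ≡⟨ ∑<-crt L t L⊥t P (unit t) per (λ k → unit-% t k) ⟩
  ∑< L P * ∑< t (unit t)                  ≡⟨ *-comm (∑< L P) _ ⟩
  ∑< t (unit t) * ∑< L P                  ∎
  where
  open ≡-Reasoning
  rearrange : ∀ P → OnUnits L P → ∀ k → unit (L * t) k * P k ≡ P k * unit t k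
  rearrange P onUnits k = begin
    unit (L * t) k * P k        ≡⟨ cong (_* P k) (unit-* L t k) ⟩
    unit L k * unit t k * P k   ≡⟨ *-assoc (unit L k) _ _ ⟩
    unit L k * (unit t k * P k) ≡⟨ cong (unit L k *_) (*-comm (unit t k) (P k)) ⟩
    unit L k * (P k * unit t k) ≡⟨ sym (*-assoc (unit L k) _ _) ⟩
    unit L k * P k * unit t k   ≡⟨ cong (_* unit t k) (unit-OnUnits L P onUnits k) ⟩
    P k * unit t k              ∎

-- Otherwise g = gcd L t > 1 and L·t = (L·g)·(t / g): a lift for (L·g, t / g)
-- gives one for (L, t) with multiplicity multiplied by g, because a function of
-- period L has period L·g and sums to g · ∑_{k<L} over [0, L·g).
uniformLift-step : ∀ L t′ g .{{_ : NonZero L}} .{{_ : NonZero g}} → g ∣ L →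
  UniformLift (L * g) {{m*n≢0 L g}} t′ → UniformLift L (g * t′)
uniformLift-step L t′ g g∣L (N′ , lift′) = N′ * g , λ P per onUnits → begin
  ∑< (L * (g * t′)) (λ k → unit (L * (g * t′)) k * P k)
    ≡⟨ cong (λ M → ∑< M (λ k → unit M k * P k)) (sym (*-assoc L g t′)) ⟩
  ∑< (L * g * t′) (λ k → unit (L * g * t′) k * P k)
    ≡⟨ lift′ P (per′ P per) (onUnits′ P onUnits) ⟩
  N′ * ∑< (L * g) P
    ≡⟨ cong (λ M → N′ * ∑< M P) (*-comm L g) ⟩
  N′ * ∑< (g * L) P
    ≡⟨ cong (N′ *_) (∑<-periods g L P (shift P per)) ⟩
  N′ * (g * ∑< L P)
    ≡⟨ sym (*-assoc N′ g _) ⟩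
  N′ * g * ∑< L P ∎
  where
  open ≡-Reasoning
  instance
    Lg≢0 : NonZero (L * g)
    Lg≢0 = m*n≢0 L g
  per′ : ∀ P → Periodic L P → Periodic (L * g) P
  per′ P per k = trans (sym (per (k % (L * g)))) (trans (cong P (m∣n⇒o%n%m≡o%m L (L * g) k (m∣m*n g))) (per k))
  -- a unit modulo L is a unit modulo g (g ∣ L), hence modulo L·g
  onUnits′ : ∀ P → OnUnits L P → OnUnits (L * g) P
  onUnits′ P onUnits k ¬k⊥Lg with gcd k L ≟ 1
  ... | yes k⊥L = ⊥-elim (¬k⊥Lg (coprime-* k k⊥L (coprime-∣ k g∣L k⊥L)))
  ... | no ¬k⊥L = onUnits k ¬k⊥L
  shift : ∀ P → Periodic L P → ∀ k → P (L + k) ≡ P k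
  shift P per k = trans (sym (per (L + k)))
    (trans (cong P (trans (cong (_% L) (+-comm L k)) ([m+n]%n≡m%n k L))) (per k))

-- Every modulus L·t (t ≥ 1) lifts uniformly; strong induction on t, where the
-- non-coprime step strictly decreases t while enlarging L.
uniformLift : ∀ t L .{{_ : NonZero L}} .{{_ : NonZero t}} → UniformLift L t
uniformLift = <-rec (λ t → ∀ L .{{_ : NonZero L}} .{{_ : NonZero t}} → UniformLift L t) step
  where
  step : ∀ t → (∀ {s} → s < t → ∀ L .{{_ : NonZero L}} .{{_ : NonZero s}} → UniformLift L s) →
         ∀ L .{{_ : NonZero L}} .{{_ : NonZero t}} → UniformLift L t
  step t rec L with gcd L t ≟ 1
  ... | yes L⊥t = uniformLift-coprime L t L⊥t
  ... | no ¬L⊥t = subst (UniformLift L) (sym t≡gt′)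
                    (uniformLift-step L t′ g (gcd[m,n]∣m L t) (rec t′<t (L * g) {{m*n≢0 L g}} {{t′≢0}}))
    where
    g : ℕ
    g = gcd L t
    instance
      g≢0 : NonZero g
      g≢0 = gcd-nonZero L t
    t′ : ℕ
    t′ = quotient (gcd[m,n]∣n L t)
    t≡gt′ : t ≡ g * t′
    t≡gt′ = m∣n⇒n≡m*quotient (gcd[m,n]∣n L t)
    t′≢0 : NonZero t′
    t′≢0 = quotient≢0 (gcd[m,n]∣n L t)
    1<g : 1 < g
    1<g = ≤∧≢⇒< (>-nonZero⁻¹ g) (¬L⊥t ∘ sym)
    t′<t : t′ < t
    t′<t = subst (t′ <_) (trans (*-comm t′ g) (sym t≡gt′)) (m<m*n t′ g {{t′≢0}} 1<g)

totient : ℕ → ℕ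
totient n = ∑< n (unit n)

-- φ(n) ≥ 1: for n ≥ 2 the term k = 1 is a unit.
totient-pos : ∀ n .{{_ : NonZero n}} → 1 ≤ totient n
totient-pos (suc zero)    = s≤s z≤n
totient-pos (suc (suc n)) = ≤-trans (≤-reflexive (sym (unit-yes (suc (suc n)) 1 (gcd-zeroˡ (suc (suc n))))))
                                    (≤-trans (m≤m+n _ _) (m≤n+m _ (unit (suc (suc n)) 0)))

totient-lift : ∀ L t .{{_ : NonZero L}} → ((N , _) : UniformLift L t) → totient (L * t) ≡ N * totient L
totient-lift L t (N , lift) = trans (∑<-cong (L * t) (λ k _ → unit-∣ k (m∣m*n t)))
                                    (lift (unit L) (λ k → unit-% L k) (unit-no L))

totient-multiplicative : ∀ A B .{{_ : NonZero A}} .{{_ : NonZero B}} → gcd A B ≡ 1 →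
  totient (A * B) ≡ totient A * totient B
totient-multiplicative A B A⊥B = trans (∑<-cong (A * B) (λ k _ → unit-* A B k))
  (∑<-crt A B A⊥B (unit A) (unit B) (λ k → unit-% A k) (λ k → unit-% B k))

oneClass : (b : ℕ) .{{_ : NonZero b}} → ℕ → ℕ
oneClass b k = 𝟙 (does (k % b ≟ 1 % b))

gcd[1%b,b] : ∀ b .{{_ : NonZero b}} → gcd (1 % b) b ≡ 1
gcd[1%b,b] b = trans (gcd-% 1 b) (gcd-zeroˡ b)

oneClass-periodic : ∀ b .{{_ : NonZero b}} → Periodic b (oneClass b)
oneClass-periodic b k = cong (λ z → 𝟙 (does (z ≟ 1 % b))) (m%n%n≡m%n k b)

oneClass-onUnits : ∀ b .{{_ : NonZero b}} → OnUnits b (oneClass b)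
oneClass-onUnits b k ¬k⊥b = 𝟙-no (k % b ≟ 1 % b)
  (λ e → ¬k⊥b (trans (sym (gcd-% k b)) (trans (cong (λ z → gcd z b) e) (gcd[1%b,b] b))))

oneClass-sum : ∀ b .{{_ : NonZero b}} → ∑< b (oneClass b) ≡ 1
oneClass-sum b = trans (∑<-single b (oneClass b) (1 % b) (m%n<n 1 b) others)
                       (𝟙-yes (1 % b % b ≟ 1 % b) (m%n%n≡m%n 1 b))
  where
  others : ∀ k → k < b → k ≢ 1 % b → oneClass b k ≡ 0
  others k k<b k≢ = 𝟙-no (k % b ≟ 1 % b) (λ e → k≢ (trans (sym (m<n⇒m%n≡m k<b)) e))

multiplicity : ∀ b t .{{_ : NonZero b}} .{{_ : NonZero t}} → ℕ
multiplicity b t = proj₁ (uniformLift t b)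

multiplicity-counts : ∀ b t .{{_ : NonZero b}} .{{_ : NonZero t}} →
  ∑< (b * t) (λ k → unit (b * t) k * oneClass b k) ≡ multiplicity b t
multiplicity-counts b t = begin
  ∑< (b * t) (λ k → unit (b * t) k * oneClass b k)
    ≡⟨ proj₂ (uniformLift t b) (oneClass b) (oneClass-periodic b) (oneClass-onUnits b) ⟩
  multiplicity b t * ∑< b (oneClass b)
    ≡⟨ cong (multiplicity b t *_) (oneClass-sum b) ⟩
  multiplicity b t * 1
    ≡⟨ *-identityʳ _ ⟩
  multiplicity b t ∎
  where open ≡-Reasoning

totient-multiplicity : ∀ b t .{{_ : NonZero b}} .{{_ : NonZero t}} → totient (b * t) ≡ multiplicity b t * totient b
totient-multiplicity b t = totient-lift b t (uniformLift t b)

oneClass-lcm : ∀ a b .{{_ : NonZero a}} .{{_ : NonZero b}} →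
  let instance _ = lcm-nonZero a b; _ = gcd-nonZero a b in
  ∑< (lcm a b) (λ k → unit (lcm a b) k * oneClass b k) ≡ ∑< a (λ x → unit a x * oneClass (gcd a b) x)
oneClass-lcm a b = begin
  ∑< l (λ k → unit l k * oneClass b k) ≡⟨ ∑<-cong l (λ k _ → sym (as𝟙 (gcd k l ≟ 1) (k % b ≟ 1 % b))) ⟩
  ∑< l (λ k → 𝟙 (p k) * 1)             ≡⟨ ∑<-reindex l a p q (λ _ → 1) (_% a) into injective onto ⟩
  ∑< a (λ x → 𝟙 (q x) * 1)             ≡⟨ ∑<-cong a (λ x _ → as𝟙 (gcd x a ≟ 1) (x % g ≟ 1 % g)) ⟩
  ∑< a (λ x → unit a x * oneClass g x) ∎
  where
  open ≡-Reasoning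
  g : ℕ
  g = gcd a b
  l : ℕ
  l = lcm a b
  instance
    g≢0 : NonZero g
    g≢0 = gcd-nonZero a b
    l≢0 : NonZero l
    l≢0 = lcm-nonZero a b
  as𝟙 : ∀ {A B : Set} (A? : Dec A) (B? : Dec B) → 𝟙 (does A? ∧ does B?) * 1 ≡ 𝟙 (does A?) * 𝟙 (does B?)
  as𝟙 A? B? = trans (*-identityʳ _) (𝟙-∧ (does A?) (does B?))
  p : ℕ → Bool
  p k = does (gcd k l ≟ 1) ∧ does (k % b ≟ 1 % b)
  q : ℕ → Bool
  q x = does (gcd x a ≟ 1) ∧ does (x % g ≟ 1 % g)
  g∣a : g ∣ a
  g∣a = gcd[m,n]∣m a b
  g∣b : g ∣ b
  g∣b = gcd[m,n]∣n a b
  into : ∀ k → k < l → p k ≡ true → k % a < a × q (k % a) ≡ true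
  into k _ pk with ∧-true {does (gcd k l ≟ 1)} pk
  ... | k⊥l , k≡1 = m%n<n k a , cong₂ _∧_
    (dec-true (gcd (k % a) a ≟ 1) (trans (gcd-% k a) (coprime-∣ k (m∣lcm[m,n] a b) (true⇒ (gcd k l ≟ 1) k⊥l))))
    (dec-true (k % a % g ≟ 1 % g) (begin
      k % a % g ≡⟨ m∣n⇒o%n%m≡o%m g a k g∣a ⟩
      k % g     ≡⟨ sym (m∣n⇒o%n%m≡o%m g b k g∣b) ⟩
      k % b % g ≡⟨ cong (_% g) (true⇒ (k % b ≟ 1 % b) k≡1) ⟩
      1 % b % g ≡⟨ m∣n⇒o%n%m≡o%m g b 1 g∣b ⟩
      1 % g     ∎))
  ≡1mod-b : ∀ k → p k ≡ true → k % b ≡ 1 % b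
  ≡1mod-b k pk = true⇒ (k % b ≟ 1 % b) (proj₂ (∧-true {does (gcd k l ≟ 1)} pk))
  injective : ∀ k k′ → k < l → k′ < l → p k ≡ true → p k′ ≡ true → k % a ≡ k′ % a → k ≡ k′
  injective k k′ k< k′< pk pk′ e = crt-unique a b k< k′< e (trans (≡1mod-b k pk) (sym (≡1mod-b k′ pk′)))
  onto : ∀ x → x < a → q x ≡ true → ∃ λ k → k < l × p k ≡ true × k % a ≡ x
  onto x x<a qx with ∧-true {does (gcd x a ≟ 1)} qx
  ... | x⊥a , x≡1 with crt-exists a b x 1 (true⇒ (x % g ≟ 1 % g) x≡1)
  ... | k , k<l , k%a , k%b = k , k<l , cong₂ _∧_ (dec-true (gcd k l ≟ 1) k⊥l) (dec-true (k % b ≟ 1 % b) k%b)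
                            , trans k%a (m<n⇒m%n≡m x<a)
    where
    k⊥a : gcd k a ≡ 1
    k⊥a = trans (sym (gcd-% k a)) (trans (cong (λ z → gcd z a) k%a) (trans (gcd-% x a) (true⇒ (gcd x a ≟ 1) x⊥a)))
    k⊥b : gcd k b ≡ 1
    k⊥b = trans (sym (gcd-% k b)) (trans (cong (λ z → gcd z b) k%b) (gcd[1%b,b] b))
    k⊥l : gcd k l ≡ 1
    k⊥l = coprime-∣ k (lcm-least {a} {b} (m∣m*n b) (n∣m*n a)) (coprime-* k k⊥a k⊥b)

-- φ(lcm a b) · φ(gcd a b) = φ(a) · φ(b).  With a = g·t and lcm a b = b·t, both
-- lifts (b to b·t, g to g·t) have the same multiplicity by oneClass-lcm.
totient-lcm-gcd : ∀ a b .{{_ : NonZero a}} .{{_ : NonZero b}} →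
  totient (lcm a b) * totient (gcd a b) ≡ totient a * totient b
totient-lcm-gcd a b = begin
  totient l * totient g         ≡⟨ cong (λ z → totient z * totient g) l≡bt ⟩
  totient (b * t) * totient g   ≡⟨ cong (_* totient g) φbt ⟩
  N₁ * totient b * totient g    ≡⟨ cong (λ z → z * totient b * totient g) N₁≡N₂ ⟩
  N₂ * totient b * totient g    ≡⟨ *-swapʳ N₂ (totient b) (totient g) ⟩
  N₂ * totient g * totient b    ≡⟨ cong (_* totient b) (sym φgt) ⟩
  totient (g * t) * totient b   ≡⟨ cong (λ z → totient z * totient b) (sym a≡gt) ⟩
  totient a * totient b         ∎
  where
  open ≡-Reasoning
  g : ℕ
  g = gcd a b
  l : ℕ
  l = lcm a b
  instance
    g≢0 : NonZero g
    g≢0 = gcd-nonZero a b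
  t : ℕ
  t = quotient (gcd[m,n]∣m a b)
  a≡gt : a ≡ g * t
  a≡gt = m∣n⇒n≡m*quotient (gcd[m,n]∣m a b)
  instance
    t≢0 : NonZero t
    t≢0 = quotient≢0 (gcd[m,n]∣m a b)
  l≡bt : l ≡ b * t
  l≡bt = *-cancelˡ-≡ l (b * t) g (begin
    g * l       ≡⟨ gcd*lcm a b ⟩
    a * b       ≡⟨ cong (_* b) a≡gt ⟩
    g * t * b   ≡⟨ *-assoc g t b ⟩
    g * (t * b) ≡⟨ cong (g *_) (*-comm t b) ⟩
    g * (b * t) ∎)
  *-swapʳ : ∀ x y z → x * y * z ≡ x * z * y
  *-swapʳ x y z = trans (*-assoc x y z) (trans (cong (x *_) (*-comm y z)) (sym (*-assoc x z y)))
  N₁ : ℕ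
  N₁ = multiplicity b t
  N₂ : ℕ
  N₂ = multiplicity g t
  φbt : totient (b * t) ≡ N₁ * totient b
  φbt = totient-multiplicity b t
  φgt : totient (g * t) ≡ N₂ * totient g
  φgt = totient-multiplicity g t
  N₁≡N₂ : N₁ ≡ N₂
  N₁≡N₂ = begin
    N₁                                                ≡⟨ sym (multiplicity-counts b t) ⟩
    ∑< (b * t) (λ k → unit (b * t) k * oneClass b k)  ≡⟨ cong (λ z → ∑< z (λ k → unit z k * oneClass b k)) (sym l≡bt) ⟩
    ∑< l (λ k → unit l k * oneClass b k)              ≡⟨ oneClass-lcm a b ⟩
    ∑< a (λ x → unit a x * oneClass g x)              ≡⟨ cong (λ z → ∑< z (λ x → unit z x * oneClass g x)) a≡gt ⟩
    ∑< (g * t) (λ x → unit (g * t) x * oneClass g x)  ≡⟨ multiplicity-counts g t ⟩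
    N₂                                                ∎

sumℕ-filter : ∀ {P : Pred ℕ 0ℓ} (P? : Decidable P) (F f : ℕ → ℕ) n →
  sumℕ (map F (filter P? (applyUpTo f n))) ≡ ∑< n (λ k → 𝟙 (does (P? (f k))) * F (f k))
sumℕ-filter P? F f zero = refl
sumℕ-filter P? F f (suc n) with does (P? (f 0))
... | true  = cong₂ _+_ (sym (+-identityʳ (F (f 0)))) (sumℕ-filter P? F (f ∘ suc) n)
... | false = sumℕ-filter P? F (f ∘ suc) n

length-filter : ∀ {P : Pred ℕ 0ℓ} (P? : Decidable P) (f : ℕ → ℕ) n →
  length (filter P? (applyUpTo f n)) ≡ ∑< n (λ k → 𝟙 (does (P? (f k))))
length-filter P? f zero = refl
length-filter P? f (suc n) with does (P? (f 0))
... | true  = cong suc (length-filter P? (f ∘ suc) n)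
... | false = length-filter P? (f ∘ suc) n

-- Defs.φ counts 1 ≤ k ≤ n, totient counts 0 ≤ k < n; the end points agree (gcd n n = gcd 0 n).
φ≡totient : ∀ n → φ n ≡ totient n
φ≡totient n = begin
  φ n
    ≡⟨ cong (length ∘ filter (λ k → gcd k n ≟ 1)) (map-upTo suc n) ⟩
  length (filter (λ k → gcd k n ≟ 1) (applyUpTo suc n))
    ≡⟨ length-filter (λ k → gcd k n ≟ 1) suc n ⟩
  ∑< n (λ k → unit n (suc k))
    ≡⟨ ∑<-shift n (unit n) (unit-cong n n 0 (trans (gcd-self n) (sym (gcd-identityˡ n)))) ⟩
  totient n ∎
  where open ≡-Reasoning

φ-nonZero : ∀ n .{{_ : NonZero n}} → NonZero (φ n)
φ-nonZero n = >-nonZero (subst (1 ≤_) (sym (φ≡totient n)) (totient-pos n))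

-- For n = d · e ≠ 0, the k < n with gcd k n = e (i.e. d · gcd k n = n) are the
-- j · e with j < d coprime to d; so there are φ(d) of them.
gcdClass : ∀ n d e .{{_ : NonZero n}} → n ≡ d * e → ∑< n (λ k → 𝟙 (does (d * gcd k n ≟ n))) ≡ totient d
gcdClass n d e n≡de = begin
  ∑< n (λ k → 𝟙 (q k))      ≡⟨ ∑<-cong n (λ k _ → sym (*-identityʳ _)) ⟩
  ∑< n (λ k → 𝟙 (q k) * 1)  ≡⟨ sym (∑<-reindex d n p q (λ _ → 1) (_* e) into injective onto) ⟩
  ∑< d (λ j → 𝟙 (p j) * 1)  ≡⟨ ∑<-cong d (λ j _ → *-identityʳ _) ⟩
  totient d                 ∎
  where
  open ≡-Reasoning
  instance
    d≢0 : NonZero d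
    d≢0 = ≢-nonZero λ d≡0 → ≢-nonZero⁻¹ n (trans n≡de (cong (_* e) d≡0))
    e≢0 : NonZero e
    e≢0 = ≢-nonZero λ e≡0 → ≢-nonZero⁻¹ n (trans n≡de (trans (cong (d *_) e≡0) (*-zeroʳ d)))
  p : ℕ → Bool
  p j = does (gcd j d ≟ 1)
  q : ℕ → Bool
  q k = does (d * gcd k n ≟ n)
  gcd[je,n] : ∀ j → gcd (j * e) n ≡ e * gcd j d
  gcd[je,n] j = trans (cong₂ gcd (*-comm j e) (trans n≡de (*-comm d e))) (sym (c*gcd[m,n]≡gcd[cm,cn] e j d))
  into : ∀ j → j < d → p j ≡ true → j * e < n × q (j * e) ≡ true
  into j j<d pj = subst (j * e <_) (sym n≡de) (*-monoˡ-< e j<d) ,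
    dec-true (d * gcd (j * e) n ≟ n)
      (trans (cong (d *_) (trans (gcd[je,n] j) (trans (cong (e *_) (true⇒ (gcd j d ≟ 1) pj)) (*-identityʳ e))))
             (sym n≡de))
  injective : ∀ j j′ → j < d → j′ < d → p j ≡ true → p j′ ≡ true → j * e ≡ j′ * e → j ≡ j′
  injective j j′ _ _ _ _ = *-cancelʳ-≡ j j′ e
  onto : ∀ k → k < n → q k ≡ true → ∃ λ j → j < d × p j ≡ true × j * e ≡ k
  onto k k<n qk = j , j<d , pj , sym k≡je
    where
    gcd≡e : gcd k n ≡ e
    gcd≡e = *-cancelˡ-≡ _ _ d (trans (true⇒ (d * gcd k n ≟ n) qk) n≡de)
    e∣k : e ∣ k
    e∣k = subst (_∣ k) gcd≡e (gcd[m,n]∣m k n)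
    j : ℕ
    j = quotient e∣k
    k≡je : k ≡ j * e
    k≡je = _∣_.equality e∣k
    j<d : j < d
    j<d = *-cancelʳ-< e j d (subst₂ _<_ k≡je n≡de k<n)
    pj : p j ≡ true
    pj = dec-true (gcd j d ≟ 1) (*-cancelˡ-≡ _ _ e
           (trans (sym (gcd[je,n] j)) (trans (cong (λ z → gcd z n) (sym k≡je)) (trans gcd≡e (sym (*-identityʳ e))))))

-- Gauss: ∑_{d ∣ n} φ(d) = n, by sorting the k < n according to d = n / gcd k n.
gauss : ∀ n .{{_ : NonZero n}} → ∑< (suc n) (λ d → 𝟙 (does (d ∣? n)) * totient d) ≡ n
gauss n = begin
  ∑< (suc n) (λ d → 𝟙 (does (d ∣? n)) * totient d) ≡⟨ ∑<-cong (suc n) (λ d _ → sym (classSize d)) ⟩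
  ∑< (suc n) (λ d → ∑< n (λ k → R k d))           ≡⟨ ∑<-swap (suc n) n (λ d k → R k d) ⟩
  ∑< n (λ k → ∑< (suc n) (R k))                   ≡⟨ ∑<-cong n (λ k k<n → uniqueClass k k<n) ⟩
  ∑< n (λ _ → 1)                                  ≡⟨ trans (∑<-const n 1) (*-identityʳ n) ⟩
  n                                               ∎
  where
  open ≡-Reasoning
  R : ℕ → ℕ → ℕ
  R k d = 𝟙 (does (d * gcd k n ≟ n))
  uniqueClass : ∀ k → k < n → ∑< (suc n) (R k) ≡ 1
  uniqueClass k k<n = trans (∑<-single (suc n) (R k) d₀ (s≤s d₀≤n) others) (𝟙-yes (d₀ * gcd k n ≟ n) (sym n≡d₀g))
    where
    g∣n : gcd k n ∣ n
    g∣n = gcd[m,n]∣n k n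
    instance
      g≢0 : NonZero (gcd k n)
      g≢0 = ≢-nonZero (gcd[m,n]≢0 k n (inj₂ (≢-nonZero⁻¹ n)))
    d₀ : ℕ
    d₀ = quotient g∣n
    n≡d₀g : n ≡ d₀ * gcd k n
    n≡d₀g = _∣_.equality g∣n
    d₀≤n : d₀ ≤ n
    d₀≤n = subst (d₀ ≤_) (sym n≡d₀g) (m≤m*n d₀ (gcd k n))
    others : ∀ d → d < suc n → d ≢ d₀ → R k d ≡ 0
    others d _ d≢d₀ = 𝟙-no (d * gcd k n ≟ n) (λ e → d≢d₀ (*-cancelʳ-≡ d d₀ (gcd k n) (trans e n≡d₀g)))
  classSize : ∀ d → ∑< n (λ k → R k d) ≡ 𝟙 (does (d ∣? n)) * totient d
  classSize d with d ∣? n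
  ... | no d∤n = ∑<-zero n _ (λ k _ → 𝟙-no (d * gcd k n ≟ n) (λ e → d∤n (divides (gcd k n) (trans (sym e) (*-comm d _)))))
  ... | yes (divides e n≡ed) = trans (gcdClass n d e (trans n≡ed (*-comm e d))) (sym (+-identityʳ (totient d)))

∑<-truncate : ∀ a b (f : ℕ → ℕ) → a ≤ b → (∀ k → f (a + k) ≡ 0) → ∑< b f ≡ ∑< a f
∑<-truncate a b f a≤b tail = begin
  ∑< b f                                ≡⟨ cong (λ z → ∑< z f) (sym (m+[n∸m]≡n a≤b)) ⟩
  ∑< (a + (b ∸ a)) f                    ≡⟨ ∑<-split a (b ∸ a) f ⟩
  ∑< a f + ∑< (b ∸ a) (λ k → f (a + k)) ≡⟨ cong (∑< a f +_) (∑<-zero (b ∸ a) _ (λ k _ → tail k)) ⟩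
  ∑< a f + 0                            ≡⟨ +-identityʳ _ ⟩
  ∑< a f                                ∎
  where open ≡-Reasoning

-- gcd c m = ∑_{d ∣ m, d ∣ c} φ(d): Gauss's identity for gcd c m, whose divisors
-- are the common divisors of c and m.
gcd-as-sum : ∀ c m .{{_ : NonZero m}} → gcd c m ≡ sumℕ (map (λ d → 𝟙 (does (d ∣? c)) * φ d) (divisors m))
gcd-as-sum c m = sym (begin
  sumℕ (map F (filter (_∣? m) (map suc (upTo m))))  ≡⟨ cong (λ l → sumℕ (map F (filter (_∣? m) l))) (map-upTo suc m) ⟩
  sumℕ (map F (filter (_∣? m) (applyUpTo suc m)))   ≡⟨ sumℕ-filter (_∣? m) F suc m ⟩
  ∑< m (λ k → H (suc k))                            ≡⟨ ∑<-cong m (λ k _ → commonDivisor (suc k)) ⟩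
  ∑< m (λ k → G (suc k))                            ≡⟨ cong (_+ ∑< m (λ k → G (suc k))) (sym G0) ⟩
  ∑< (suc m) G                                      ≡⟨ ∑<-truncate (suc g) (suc m) G (s≤s (∣⇒≤ (gcd[m,n]∣n c m))) beyond ⟩
  ∑< (suc g) G                                      ≡⟨ gauss g ⟩
  g                                                 ∎)
  where
  open ≡-Reasoning
  g : ℕ
  g = gcd c m
  instance
    g≢0 : NonZero g
    g≢0 = ≢-nonZero (gcd[m,n]≢0 c m (inj₂ (≢-nonZero⁻¹ m)))
  F : ℕ → ℕ
  F d = 𝟙 (does (d ∣? c)) * φ d
  H : ℕ → ℕ
  H d = 𝟙 (does (d ∣? m)) * F d
  G : ℕ → ℕ
  G d = 𝟙 (does (d ∣? g)) * totient d
  G0 : G 0 ≡ 0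
  G0 = cong (_* totient 0) (𝟙-no (0 ∣? g) (λ 0∣g → ≢-nonZero⁻¹ g (0∣⇒≡0 0∣g)))
  commonDivisor : ∀ d → H d ≡ G d
  commonDivisor d = byCases (d ∣? m) (d ∣? c)
    where
    byCases : Dec (d ∣ m) → Dec (d ∣ c) → H d ≡ G d
    byCases (yes d∣m) (yes d∣c) rewrite 𝟙-yes (d ∣? m) d∣m | 𝟙-yes (d ∣? c) d∣c
      | 𝟙-yes (d ∣? g) (gcd-greatest d∣c d∣m) | φ≡totient d = cong (1 *_) (*-identityˡ (totient d))
    byCases (no d∤m) _ rewrite 𝟙-no (d ∣? m) d∤m
      | 𝟙-no (d ∣? g) (d∤m ∘ (λ d∣g → ∣-trans d∣g (gcd[m,n]∣n c m))) = refl
    byCases (yes d∣m) (no d∤c) rewrite 𝟙-yes (d ∣? m) d∣m | 𝟙-no (d ∣? c) d∤c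
      | 𝟙-no (d ∣? g) (d∤c ∘ (λ d∣g → ∣-trans d∣g (gcd[m,n]∣m c m))) = refl
  beyond : ∀ k → G (suc g + k) ≡ 0
  beyond k = cong (_* totient (suc g + k)) (𝟙-no (suc g + k ∣? g) (λ d∣g → <⇒≱ (s≤s (m≤m+n g k)) (∣⇒≤ d∣g)))

-- Integer polynomials respect congruences: e ∣ x - y implies e ∣ g(x) - g(y),
-- since g(x) - g(y) = x · (h(x) - h(y)) + (x - y) · h(y) for g = c + X · h.
poly-cong : ∀ cs {e} x y → e Signed.∣ x ℤ.- y → e Signed.∣ eval cs x ℤ.- eval cs y
poly-cong []       {e} x y _ = Signed.divides (ℤ.+ 0) (sym (ℤ.*-zeroˡ e))
poly-cong (c ∷ cs)     x y e∣x-y = subst (_ Signed.∣_) (sym (split c x y (eval cs x) (eval cs y)))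
  (Signed.∣m∣n⇒∣m+n (Signed.∣n⇒∣m*n x (poly-cong cs x y e∣x-y)) (Signed.∣m⇒∣m*n (eval cs y) e∣x-y))
  where
  split : ∀ c x y hx hy → (c ℤ.+ x ℤ.* hx) ℤ.- (c ℤ.+ y ℤ.* hy) ≡ x ℤ.* (hx ℤ.- hy) ℤ.+ (x ℤ.- y) ℤ.* hy
  split = ℤ-Solver.solve-∀

∣k-k%n : ∀ n .{{_ : NonZero n}} k → ℤ.+ n Signed.∣ ℤ.+ k ℤ.- ℤ.+ (k % n)
∣k-k%n n k = Signed.divides (ℤ.+ (k / n)) (begin
  ℤ.+ k ℤ.- ℤ.+ (k % n)                             ≡⟨ cong (λ x → ℤ.+ x ℤ.- ℤ.+ (k % n)) (m≡m%n+[m/n]*n k n) ⟩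
  ℤ.+ (k % n + k / n * n) ℤ.- ℤ.+ (k % n)           ≡⟨ cong (ℤ._- ℤ.+ (k % n)) (ℤ.pos-+ (k % n) (k / n * n)) ⟩
  (ℤ.+ (k % n) ℤ.+ ℤ.+ (k / n * n)) ℤ.- ℤ.+ (k % n) ≡⟨ cancel (ℤ.+ (k % n)) (ℤ.+ (k / n * n)) ⟩
  ℤ.+ (k / n * n)                                   ≡⟨ ℤ.pos-* (k / n) n ⟩
  ℤ.+ (k / n) ℤ.* ℤ.+ n                             ∎)
  where
  open ≡-Reasoning
  cancel : ∀ a b → (a ℤ.+ b) ℤ.- a ≡ b
  cancel = ℤ-Solver.solve-∀

poly-% : ∀ cs n .{{_ : NonZero n}} k {e} → e ∣ n → ℤ.+ e Signed.∣ eval cs (ℤ.+ k) ℤ.- eval cs (ℤ.+ (k % n))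
poly-% cs n k e∣n = Signed.∣-trans (Signed.∣ᵤ⇒∣ e∣n) (poly-cong cs (ℤ.+ k) (ℤ.+ (k % n)) (∣k-k%n n k))

∣-congruent : ∀ {d e} a b → d ∣ e → ℤ.+ e Signed.∣ a ℤ.- b → (d ∣ ∣ a ∣) ⇔ (d ∣ ∣ b ∣)
∣-congruent {d} a b d∣e e∣a-b = mk⇔ to from
  where
  d∣a-b : ℤ.+ d Signed.∣ a ℤ.- b
  d∣a-b = Signed.∣-trans (Signed.∣ᵤ⇒∣ d∣e) e∣a-b
  to : d ∣ ∣ a ∣ → d ∣ ∣ b ∣
  to d∣a = Signed.∣⇒∣ᵤ (subst (_ Signed.∣_) (ℤ.neg-involutive b)
             (Signed.∣m⇒∣-m (Signed.∣m+n∣m⇒∣n {m = a} d∣a-b (Signed.∣ᵤ⇒∣ {i = a} d∣a))))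
  from : d ∣ ∣ b ∣ → d ∣ ∣ a ∣
  from d∣b = Signed.∣⇒∣ᵤ (Signed.∣m+n∣n⇒∣m {m = a} d∣a-b (Signed.∣m⇒∣-m {m = b} (Signed.∣ᵤ⇒∣ {i = b} d∣b)))

gcd-congruent : ∀ {e} a b → ℤ.+ e Signed.∣ a ℤ.- b → gcd (∣ a ∣) e ≡ gcd (∣ b ∣) e
gcd-congruent {e} a b e∣a-b = GCD.unique (gcd-GCD (∣ a ∣) e)
  (GCD.is (Equivalence.from (∣-congruent a b gcd∣e e∣a-b) (gcd[m,n]∣m (∣ b ∣) e) , gcd∣e)
          (λ { (d∣a , d∣e) → gcd-greatest (Equivalence.to (∣-congruent a b d∣e e∣a-b) d∣a) d∣e }))
  where
  gcd∣e : gcd (∣ b ∣) e ∣ e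
  gcd∣e = gcd[m,n]∣n (∣ b ∣) e

poly-∣-% : ∀ cs n .{{_ : NonZero n}} k {e} → e ∣ n →
  does (e ∣? ∣ eval cs (ℤ.+ (k % n)) ∣) ≡ does (e ∣? ∣ eval cs (ℤ.+ k) ∣)
poly-∣-% cs n k {e} e∣n = does-⇔ (mk⇔ (Equivalence.from same) (Equivalence.to same)) (e ∣? _) (e ∣? _)
  where
  same : (e ∣ ∣ eval cs (ℤ.+ k) ∣) ⇔ (e ∣ ∣ eval cs (ℤ.+ (k % n)) ∣)
  same = ∣-congruent (eval cs (ℤ.+ k)) (eval cs (ℤ.+ (k % n))) ∣-refl (poly-% cs n k e∣n)

poly-gcd-% : ∀ cs n .{{_ : NonZero n}} k {e} → e ∣ n → gcd (∣ eval cs (ℤ.+ (k % n)) ∣) e ≡ gcd (∣ eval cs (ℤ.+ k) ∣) e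
poly-gcd-% cs n k e∣n = sym (gcd-congruent (eval cs (ℤ.+ k)) (eval cs (ℤ.+ (k % n))) (poly-% cs n k e∣n))

sumℕ-congᴬ : ∀ {A : Set} {P : A → Set} {xs} (f g : A → ℕ) → All P xs → (∀ x → P x → f x ≡ g x) →
  sumℕ (map f xs) ≡ sumℕ (map g xs)
sumℕ-congᴬ f g []         h = refl
sumℕ-congᴬ f g (px ∷ pxs) h = cong₂ _+_ (h _ px) (sumℕ-congᴬ f g pxs h)

sumℕ-map : ∀ {A B : Set} (f : B → ℕ) (g : A → B) xs → sumℕ (map f (map g xs)) ≡ sumℕ (map (f ∘ g) xs)
sumℕ-map f g []       = refl
sumℕ-map f g (x ∷ xs) = cong (f (g x) +_) (sumℕ-map f g xs)

sumℕ-++ : ∀ {A : Set} (f : A → ℕ) xs ys → sumℕ (map f (xs ++ ys)) ≡ sumℕ (map f xs) + sumℕ (map f ys)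
sumℕ-++ f []       ys = refl
sumℕ-++ f (x ∷ xs) ys = trans (cong (f x +_) (sumℕ-++ f xs ys)) (sym (+-assoc (f x) _ _))

sumℕ-concatMap : ∀ {A B : Set} (f : B → ℕ) (g : A → List B) xs →
  sumℕ (map f (concatMap g xs)) ≡ sumℕ (map (λ x → sumℕ (map f (g x))) xs)
sumℕ-concatMap f g []       = refl
sumℕ-concatMap f g (x ∷ xs) = trans (sumℕ-++ f (g x) (concatMap g xs))
                                    (cong (sumℕ (map f (g x)) +_) (sumℕ-concatMap f g xs))

sumℕ-*ˡ : ∀ {A : Set} c (f : A → ℕ) xs → sumℕ (map (λ x → c * f x) xs) ≡ c * sumℕ (map f xs)
sumℕ-*ˡ c f []       = sym (*-zeroʳ c)
sumℕ-*ˡ c f (x ∷ xs) = trans (cong (c * f x +_) (sumℕ-*ˡ c f xs)) (sym (*-distribˡ-+ c (f x) _))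

sumℕ-*ʳ : ∀ {A : Set} c (f : A → ℕ) xs → sumℕ (map (λ x → f x * c) xs) ≡ sumℕ (map f xs) * c
sumℕ-*ʳ c f xs = trans (cong sumℕ (map-cong (λ x → *-comm (f x) c) xs)) (trans (sumℕ-*ˡ c f xs) (*-comm c _))

sumℕ-∑< : ∀ {A : Set} n (F : A → ℕ → ℕ) xs → sumℕ (map (λ x → ∑< n (F x)) xs) ≡ ∑< n (λ k → sumℕ (map (λ x → F x k) xs))
sumℕ-∑< n F []       = sym (∑<-zero n _ (λ _ _ → refl))
sumℕ-∑< n F (x ∷ xs) = trans (cong (∑< n (F x) +_) (sumℕ-∑< n F xs)) (sym (∑<-+ n (F x) _))

prodFin-cong : ∀ r (f g : Fin r → ℕ) → (∀ i → f i ≡ g i) → prodFin r f ≡ prodFin r g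
prodFin-cong zero    f g h = refl
prodFin-cong (suc r) f g h = cong₂ _*_ (h Fin.zero) (prodFin-cong r _ _ (h ∘ Fin.suc))

prodFin-* : ∀ r (f g : Fin r → ℕ) → prodFin r (λ i → f i * g i) ≡ prodFin r f * prodFin r g
prodFin-* zero    f g = refl
prodFin-* (suc r) f g = trans (cong (f Fin.zero * g Fin.zero *_) (prodFin-* r (f ∘ Fin.suc) (g ∘ Fin.suc)))
                              (*-interchange (f Fin.zero) (g Fin.zero) _ _)

prodFin-pos : ∀ r (d : Fin r → ℕ) → (∀ i → 1 ≤ d i) → 1 ≤ prodFin r d
prodFin-pos zero    d h = s≤s z≤n
prodFin-pos (suc r) d h = *-mono-≤ (h Fin.zero) (prodFin-pos r (d ∘ Fin.suc) (h ∘ Fin.suc))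

prodFin-∣ : ∀ r (d : Fin r → ℕ) i → d i ∣ prodFin r d
prodFin-∣ (suc r) d Fin.zero    = m∣m*n _
prodFin-∣ (suc r) d (Fin.suc i) = ∣n⇒∣m*n (d Fin.zero) (prodFin-∣ r (d ∘ Fin.suc) i)

lcmFin-∣ : ∀ r (d : Fin r → ℕ) i → d i ∣ lcmFin r d
lcmFin-∣ (suc r) d Fin.zero    = m∣lcm[m,n] (d Fin.zero) _
lcmFin-∣ (suc r) d (Fin.suc i) = ∣-trans (lcmFin-∣ r (d ∘ Fin.suc) i) (n∣lcm[m,n] (d Fin.zero) _)

lcmFin-least : ∀ r (d : Fin r → ℕ) {M} → (∀ i → d i ∣ M) → lcmFin r d ∣ M
lcmFin-least zero    d h = 1∣ _
lcmFin-least (suc r) d h = lcm-least (h Fin.zero) (lcmFin-least r (d ∘ Fin.suc) (h ∘ Fin.suc))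

lcmFin-nonZero : ∀ r (d : Fin r → ℕ) → (∀ i → 1 ≤ d i) → NonZero (lcmFin r d)
lcmFin-nonZero zero    d h = _
lcmFin-nonZero (suc r) d h =
  lcm-nonZero (d Fin.zero) _ {{>-nonZero (h Fin.zero)}} {{lcmFin-nonZero r (d ∘ Fin.suc) (h ∘ Fin.suc)}}

lcmFin-∣-prodFin : ∀ r (d : Fin r → ℕ) → lcmFin r d ∣ prodFin r d
lcmFin-∣-prodFin r d = lcmFin-least r d (prodFin-∣ r d)

coprime-prodFin : ∀ k r (d : Fin r → ℕ) → (∀ i → gcd k (d i) ≡ 1) → gcd k (prodFin r d) ≡ 1
coprime-prodFin k zero    d h = gcd-zeroʳ k
coprime-prodFin k (suc r) d h = coprime-* k (h Fin.zero) (coprime-prodFin k r (d ∘ Fin.suc) (h ∘ Fin.suc))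

𝟙-allFin : ∀ r (f : Fin r → Bool) → 𝟙 (allFin r f) ≡ prodFin r (𝟙 ∘ f)
𝟙-allFin zero    f = refl
𝟙-allFin (suc r) f = trans (𝟙-∧ (f Fin.zero) _) (cong (𝟙 (f Fin.zero) *_) (𝟙-allFin r (f ∘ Fin.suc)))

allFin-true : ∀ r (f : Fin r → Bool) → allFin r f ≡ true → ∀ i → f i ≡ true
allFin-true (suc r) f h Fin.zero    = proj₁ (∧-true {f Fin.zero} h)
allFin-true (suc r) f h (Fin.suc i) = allFin-true r (f ∘ Fin.suc) (proj₂ (∧-true {f Fin.zero} h)) i

allFin-cong : ∀ r (f g : Fin r → Bool) → (∀ i → f i ≡ g i) → allFin r f ≡ allFin r g
allFin-cong zero    f g h = refl
allFin-cong (suc r) f g h = cong₂ _∧_ (h Fin.zero) (allFin-cong r _ _ (h ∘ Fin.suc))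

prodFin-of-sums : ∀ r (F : Fin r → ℕ → ℕ) (m : Fin r → ℕ) →
  prodFin r (λ i → sumℕ (map (F i) (divisors (m i)))) ≡ sumℕ (map (λ d → prodFin r (λ i → F i (d i))) (divTuples r m))
prodFin-of-sums zero    F m = refl
prodFin-of-sums (suc r) F m = begin
  S₀ * prodFin r (λ i → sumℕ (map (F (Fin.suc i)) (divisors (m (Fin.suc i)))))
    ≡⟨ cong (S₀ *_) (prodFin-of-sums r (F ∘ Fin.suc) (m ∘ Fin.suc)) ⟩
  S₀ * sumℕ (map Ψ T)
    ≡⟨ sym (sumℕ-*ʳ (sumℕ (map Ψ T)) (F Fin.zero) (divisors (m Fin.zero))) ⟩
  sumℕ (map (λ e → F Fin.zero e * sumℕ (map Ψ T)) (divisors (m Fin.zero)))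
    ≡⟨ cong sumℕ (map-cong (λ e → trans (sym (sumℕ-*ˡ (F Fin.zero e) Ψ T)) (sym (sumℕ-map Φ (consFin e) T)))
                           (divisors (m Fin.zero))) ⟩
  sumℕ (map (λ e → sumℕ (map Φ (map (consFin e) T))) (divisors (m Fin.zero)))
    ≡⟨ sym (sumℕ-concatMap Φ (λ e → map (consFin e) T) (divisors (m Fin.zero))) ⟩
  sumℕ (map Φ (divTuples (suc r) m))
    ∎
  where
  open ≡-Reasoning
  S₀ : ℕ
  S₀ = sumℕ (map (F Fin.zero) (divisors (m Fin.zero)))
  T : List (Fin r → ℕ)
  T = divTuples r (m ∘ Fin.suc)
  Ψ : (Fin r → ℕ) → ℕ
  Ψ t = prodFin r (λ i → F (Fin.suc i) (t i))
  Φ : (Fin (suc r) → ℕ) → ℕ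
  Φ d = prodFin (suc r) (λ i → F i (d i))

DivisorTuple : ∀ r → (Fin r → ℕ) → (Fin r → ℕ) → Set
DivisorTuple r m d = ∀ i → d i ∣ m i × 1 ≤ d i

divisors-valid : ∀ m → All (λ d → d ∣ m × 1 ≤ d) (divisors m)
divisors-valid m = All.zip (All.all-filter (_∣? m) (map suc (upTo m)) ,
  All.filter⁺ (_∣? m) (All.map⁺ (All.applyUpTo⁺₂ (λ x → x) m (λ _ → s≤s z≤n))))

divTuples-valid : ∀ r m → All (DivisorTuple r m) (divTuples r m)
divTuples-valid zero    m = (λ ()) ∷ []
divTuples-valid (suc r) m = All.concat⁺ (All.map⁺ (All.map extend (divisors-valid (m Fin.zero))))
  where
  extend : ∀ {e} → e ∣ m Fin.zero × 1 ≤ e →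
    All (DivisorTuple (suc r) m) (map (consFin e) (divTuples r (m ∘ Fin.suc)))
  extend valid = All.map⁺ (All.map (λ valid′ → λ { Fin.zero → valid ; (Fin.suc i) → valid′ i })
                                   (divTuples-valid r (m ∘ Fin.suc)))

-- φ(lcm[d₁,…,d_r]) ∣ φ(d₁)⋯φ(d_r), by induction from φ(lcm a b) ∣ φ(a) φ(b).
totient-lcmFin-∣ : ∀ r (d : Fin r → ℕ) → (∀ i → 1 ≤ d i) → totient (lcmFin r d) ∣ prodFin r (totient ∘ d)
totient-lcmFin-∣ zero    d h = ∣-refl
totient-lcmFin-∣ (suc r) d h = ∣-trans (m∣m*n (totient (gcd d₀ L)))
  (subst (_∣ totient d₀ * prodFin r (totient ∘ d ∘ Fin.suc)) (sym (totient-lcm-gcd d₀ L))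
    (*-monoʳ-∣ (totient d₀) (totient-lcmFin-∣ r (d ∘ Fin.suc) (h ∘ Fin.suc))))
  where
  d₀ : ℕ
  d₀ = d Fin.zero
  L : ℕ
  L = lcmFin r (d ∘ Fin.suc)
  instance
    d₀≢0 : NonZero d₀
    d₀≢0 = >-nonZero (h Fin.zero)
    L≢0 : NonZero L
    L≢0 = lcmFin-nonZero r (d ∘ Fin.suc) (h ∘ Fin.suc)

n/1 : ℕ → ℚ
n/1 n = mkℚ (ℤ.+ n) 0 (Coprime.sym (1-coprimeTo n))

toℚ≡mkℚ : ∀ n → toℚ n ≡ n/1 n
toℚ≡mkℚ n = ℚ.normalize-coprime (Coprime.sym (1-coprimeTo n))

toℚ-+ : ∀ a b → toℚ (a + b) ≡ toℚ a ℚ.+ toℚ b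
toℚ-+ a b rewrite toℚ≡mkℚ a | toℚ≡mkℚ b | toℚ≡mkℚ (a + b) = ℚ.toℚᵘ-injective
  (ℚᵘ.≃-trans (ℚᵘ.*≡* (trans (cong (ℤ._* ℤ.+ 1) (ℤ.pos-+ a b)) (over1 (ℤ.+ a) (ℤ.+ b))))
              (ℚᵘ.≃-sym (ℚ.toℚᵘ-homo-+ (n/1 a) (n/1 b))))
  where
  over1 : ∀ x y → (x ℤ.+ y) ℤ.* ℤ.+ 1 ≡ (x ℤ.* ℤ.+ 1 ℤ.+ y ℤ.* ℤ.+ 1) ℤ.* ℤ.+ 1
  over1 = ℤ-Solver.solve-∀

toℚ-* : ∀ a b → toℚ (a * b) ≡ toℚ a ℚ.* toℚ b
toℚ-* a b rewrite toℚ≡mkℚ a | toℚ≡mkℚ b | toℚ≡mkℚ (a * b) = ℚ.toℚᵘ-injective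
  (ℚᵘ.≃-trans (ℚᵘ.*≡* (cong (ℤ._* ℤ.+ 1) (ℤ.pos-* a b)))
              (ℚᵘ.≃-sym (ℚ.toℚᵘ-homo-* (n/1 a) (n/1 b))))

toℚ-÷ : ∀ c b .{{_ : NonZero b}} → toℚ (c * b) ÷ℕ b ≡ toℚ c
toℚ-÷ c (suc n) rewrite toℚ≡mkℚ c | toℚ≡mkℚ (c * suc n) | ℚ.normalize-coprime {1} {n} (1-coprimeTo (suc n)) =
  ℚ.toℚᵘ-injective (ℚᵘ.≃-trans (ℚ.toℚᵘ-homo-* (n/1 (c * suc n)) (mkℚ (ℤ.+ 1) n (1-coprimeTo (suc n)))) (ℚᵘ.*≡* cross))
  where
  cross : (ℤ.+ (c * suc n) ℤ.* ℤ.+ 1) ℤ.* ℤ.+ 1 ≡ ℤ.+ c ℤ.* ℤ.+ (1 * suc n)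
  cross = trans (ℤ.*-identityʳ _) (trans (ℤ.*-identityʳ _)
                (trans (ℤ.pos-* c (suc n)) (cong (λ z → ℤ.+ c ℤ.* ℤ.+ z) (sym (*-identityˡ (suc n))))))

toℚ-sum : ∀ {A : Set} (f : A → ℕ) xs → sumℚ (map (toℚ ∘ f) xs) ≡ toℚ (sumℕ (map f xs))
toℚ-sum f []       = refl
toℚ-sum f (x ∷ xs) = trans (cong (toℚ (f x) ℚ.+_) (toℚ-sum f xs)) (sym (toℚ-+ (f x) _))

toℚ-≡0 : ∀ n → toℚ n ≡ 0ℚ → n ≡ 0
toℚ-≡0 n h rewrite toℚ≡mkℚ n = ℤ.+-injective (cong ℚ.numerator h)

sumℚ-congᴬ : ∀ {A : Set} {P : A → Set} {xs} {f g : A → ℚ} → All P xs → (∀ x → P x → f x ≡ g x) →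
  sumℚ (map f xs) ≡ sumℚ (map g xs)
sumℚ-congᴬ []         h = refl
sumℚ-congᴬ (px ∷ pxs) h = cong₂ ℚ._+_ (h _ px) (sumℚ-congᴬ pxs h)

-- Division that is total (x / 0 = 0); only ever applied to positive divisors.
_/₀_ : ℕ → ℕ → ℕ
a /₀ zero  = 0
a /₀ suc b = a / suc b

/₀-exact : ∀ a b .{{_ : NonZero b}} → b ∣ a → a ≡ (a /₀ b) * b
/₀-exact a (suc b) b∣a = sym (m/n*n≡m b∣a)

module Main (r : ℕ) (G : Fin r → Poly) where

  value : Fin r → ℕ → ℕ
  value i k = ∣ eval (G i) (ℤ.+ k) ∣

  gcdProd : (Fin r → ℕ) → ℕ → ℕ
  gcdProd m k = prodFin r (λ i → gcd (value i k) (m i))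

  -- ∑_{k < M, gcd(k, M) = 1} gcdProd m k = φ(M) · LHS.
  unitSum : (Fin r → ℕ) → ℕ → ℕ
  unitSum m M = ∑< M (λ k → unit M k * gcdProd m k)

  divInd : (Fin r → ℕ) → ℕ → ℕ
  divInd d k = prodFin r (λ i → 𝟙 (does (d i ∣? value i k)))

  counted : (Fin r → ℕ) → ℕ → Bool
  counted d x = allFin r (λ i → ⌊ d i ∣? value i x ⌋ ∧ ⌊ gcd x (d i) ≟ 1 ⌋)

  -- φ(d₁)⋯φ(d_r) and its quotient by φ(lcm d), an integer by totient-lcmFin-∣.
  Φ : (Fin r → ℕ) → ℕ
  Φ d = prodFin r (φ ∘ d)

  coeff : (Fin r → ℕ) → ℕ
  coeff d = Φ d /₀ φ (lcmFin r d)

  R : (Fin r → ℕ) → ℕ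
  R m = sumℕ (map (λ d → coeff d * η r G d) (divTuples r m))

  η-as-sum : ∀ d → η r G d ≡ ∑< (lcmFin r d) (𝟙 ∘ counted d)
  η-as-sum d = trans (length-filter (λ x → counted d x Data.Bool.≟ true) (λ x → x) (lcmFin r d))
                     (∑<-cong (lcmFin r d) (λ x _ → 𝟙-≟true (counted d x)))
    where
    𝟙-≟true : ∀ b → 𝟙 (does (b Data.Bool.≟ true)) ≡ 𝟙 b
    𝟙-≟true true  = refl
    𝟙-≟true false = refl

  Φ-exact : ∀ d → (∀ i → 1 ≤ d i) → Φ d ≡ coeff d * φ (lcmFin r d)
  Φ-exact d d≥1 = /₀-exact (Φ d) (φ L) {{φ-nonZero L {{lcmFin-nonZero r d d≥1}}}}
    (subst₂ _∣_ (sym (φ≡totient L)) (sym (prodFin-cong r _ _ (φ≡totient ∘ d))) (totient-lcmFin-∣ r d d≥1))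
    where
    L : ℕ
    L = lcmFin r d

  gcdProd-expand : ∀ m → (∀ i → 1 ≤ m i) → ∀ k → gcdProd m k ≡ sumℕ (map (λ d → divInd d k * Φ d) (divTuples r m))
  gcdProd-expand m m≥1 k = begin
    gcdProd m k
      ≡⟨ prodFin-cong r _ _ (λ i → gcd-as-sum (value i k) (m i) {{>-nonZero (m≥1 i)}}) ⟩
    prodFin r (λ i → sumℕ (map (λ e → 𝟙 (does (e ∣? value i k)) * φ e) (divisors (m i))))
      ≡⟨ prodFin-of-sums r (λ i e → 𝟙 (does (e ∣? value i k)) * φ e) m ⟩
    sumℕ (map (λ d → prodFin r (λ i → 𝟙 (does (d i ∣? value i k)) * φ (d i))) (divTuples r m))
      ≡⟨ cong sumℕ (map-cong (λ d → prodFin-* r _ _) (divTuples r m)) ⟩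
    sumℕ (map (λ d → divInd d k * Φ d) (divTuples r m))
      ∎
    where open ≡-Reasoning

  gcdProd-periodic : ∀ m M .{{_ : NonZero M}} → (∀ i → m i ∣ M) → Periodic M (gcdProd m)
  gcdProd-periodic m M m∣M k = prodFin-cong r _ _ (λ i → poly-gcd-% (G i) M k (m∣M i))

  -- On the units modulo a common multiple M of the d_i, divInd d agrees with counted d
  -- (the coprimality conditions gcd(k, d_i) = 1 then hold automatically).
  divInd-on-units : ∀ d M k → (∀ i → d i ∣ M) → unit M k * divInd d k ≡ unit M k * 𝟙 (counted d k)
  divInd-on-units d M k d∣M = byCases (gcd k M ≟ 1)
    where
    byCases : Dec (gcd k M ≡ 1) → unit M k * divInd d k ≡ unit M k * 𝟙 (counted d k)
    byCases (no ¬k⊥M) rewrite unit-no M k ¬k⊥M = refl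
    byCases (yes k⊥M) rewrite unit-yes M k k⊥M =
      cong (_+ 0) (sym (trans (𝟙-allFin r _) (prodFin-cong r _ _ factor)))
      where
      factor : ∀ i → 𝟙 (⌊ d i ∣? value i k ⌋ ∧ ⌊ gcd k (d i) ≟ 1 ⌋) ≡ 𝟙 (does (d i ∣? value i k))
      factor i rewrite isYes≗does (d i ∣? value i k) | isYes≗does (gcd k (d i) ≟ 1)
                     | 𝟙-∧ (does (d i ∣? value i k)) (does (gcd k (d i) ≟ 1))
                     | 𝟙-yes (gcd k (d i) ≟ 1) (coprime-∣ k (d∣M i) k⊥M) = *-identityʳ _

  counted-periodic : ∀ d (d≥1 : ∀ i → 1 ≤ d i) → Periodic (lcmFin r d) {{lcmFin-nonZero r d d≥1}} (𝟙 ∘ counted d)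
  counted-periodic d d≥1 k = cong 𝟙 (allFin-cong r _ _ (λ i → cong₂ _∧_ (divides-% i) (coprime-% i)))
    where
    instance
      L≢0 : NonZero (lcmFin r d)
      L≢0 = lcmFin-nonZero r d d≥1
    L : ℕ
    L = lcmFin r d
    divides-% : ∀ i → ⌊ d i ∣? value i (k % L) ⌋ ≡ ⌊ d i ∣? value i k ⌋
    divides-% i rewrite isYes≗does (d i ∣? value i (k % L)) | isYes≗does (d i ∣? value i k) =
      poly-∣-% (G i) L k (lcmFin-∣ r d i)
    coprime-% : ∀ i → ⌊ gcd (k % L) (d i) ≟ 1 ⌋ ≡ ⌊ gcd k (d i) ≟ 1 ⌋
    coprime-% i = cong (λ g → ⌊ g ≟ 1 ⌋) (begin
      gcd (k % L) (d i)            ≡⟨ sym (gcd-% (k % L) (d i)) ⟩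
      gcd (k % L % d i) (d i)      ≡⟨ cong (λ z → gcd z (d i)) (m∣n⇒o%n%m≡o%m (d i) L k (lcmFin-∣ r d i)) ⟩
      gcd (k % d i) (d i)          ≡⟨ gcd-% k (d i) ⟩
      gcd k (d i)                  ∎)
      where
      open ≡-Reasoning
      instance
        dᵢ≢0 : NonZero (d i)
        dᵢ≢0 = >-nonZero (d≥1 i)

  counted-onUnits : ∀ d → OnUnits (lcmFin r d) (𝟙 ∘ counted d)
  counted-onUnits d k ¬k⊥L with counted d k in eq
  ... | false = refl
  ... | true  = ⊥-elim (¬k⊥L (coprime-∣ k (lcmFin-∣-prodFin r d) (coprime-prodFin k r d k⊥dᵢ)))
    where
    k⊥dᵢ : ∀ i → gcd k (d i) ≡ 1
    k⊥dᵢ i = true⇒ (gcd k (d i) ≟ 1) (trans (sym (isYes≗does (gcd k (d i) ≟ 1)))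
               (proj₂ (∧-true {⌊ d i ∣? value i k ⌋} (allFin-true r _ eq i))))

  unitClass : ∀ d M .{{_ : NonZero M}} → (∀ i → 1 ≤ d i) → lcmFin r d ∣ M →
    ∃ λ N → ∑< M (λ k → unit M k * divInd d k) ≡ N * η r G d × totient M ≡ N * totient (lcmFin r d)
  unitClass d M d≥1 L∣M = N , classSum , subst (λ z → totient z ≡ N * totient L) (sym M≡Lt) (totient-lift L t lift)
    where
    L : ℕ
    L = lcmFin r d
    instance
      L≢0 : NonZero L
      L≢0 = lcmFin-nonZero r d d≥1
    t : ℕ
    t = quotient L∣M
    M≡Lt : M ≡ L * t
    M≡Lt = m∣n⇒n≡m*quotient L∣M
    instance
      t≢0 : NonZero t
      t≢0 = quotient≢0 L∣M
    lift : UniformLift L t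
    lift = uniformLift t L
    N : ℕ
    N = proj₁ lift
    classSum : ∑< M (λ k → unit M k * divInd d k) ≡ N * η r G d
    classSum = begin
      ∑< M (λ k → unit M k * divInd d k)
        ≡⟨ ∑<-cong M (λ k _ → divInd-on-units d M k (λ i → ∣-trans (lcmFin-∣ r d i) L∣M)) ⟩
      ∑< M (λ k → unit M k * 𝟙 (counted d k))
        ≡⟨ cong (λ z → ∑< z (λ k → unit z k * 𝟙 (counted d k))) M≡Lt ⟩
      ∑< (L * t) (λ k → unit (L * t) k * 𝟙 (counted d k))
        ≡⟨ proj₂ lift (𝟙 ∘ counted d) (counted-periodic d d≥1) (counted-onUnits d) ⟩
      N * ∑< L (𝟙 ∘ counted d)
        ≡⟨ cong (N *_) (sym (η-as-sum d)) ⟩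
      N * η r G d ∎
      where open ≡-Reasoning

  unitSum-formula : ∀ m M .{{_ : NonZero M}} → (∀ i → 1 ≤ m i) → lcmFin r m ∣ M → unitSum m M ≡ totient M * R m
  unitSum-formula m M m≥1 L∣M = begin
    ∑< M (λ k → unit M k * gcdProd m k)
      ≡⟨ ∑<-cong M (λ k _ → trans (cong (unit M k *_) (gcdProd-expand m m≥1 k)) (sym (sumℕ-*ˡ (unit M k) _ tuples))) ⟩
    ∑< M (λ k → sumℕ (map (λ d → unit M k * (divInd d k * Φ d)) tuples))
      ≡⟨ sym (sumℕ-∑< M (λ d k → unit M k * (divInd d k * Φ d)) tuples) ⟩
    sumℕ (map (λ d → ∑< M (λ k → unit M k * (divInd d k * Φ d))) tuples)
      ≡⟨ sumℕ-congᴬ _ _ (divTuples-valid r m) tupleTerm ⟩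
    sumℕ (map (λ d → totient M * (coeff d * η r G d)) tuples)
      ≡⟨ sumℕ-*ˡ (totient M) _ tuples ⟩
    totient M * R m
      ∎
    where
    open ≡-Reasoning
    tuples : List (Fin r → ℕ)
    tuples = divTuples r m
    tupleTerm : ∀ d → DivisorTuple r m d → ∑< M (λ k → unit M k * (divInd d k * Φ d)) ≡ totient M * (coeff d * η r G d)
    tupleTerm d valid
      with unitClass d M (proj₂ ∘ valid) (lcmFin-least r d (λ i → ∣-trans (proj₁ (valid i)) (∣-trans (lcmFin-∣ r m i) L∣M)))
    ... | N , classSum , φM≡NφL = begin
      ∑< M (λ k → unit M k * (divInd d k * Φ d))
        ≡⟨ ∑<-cong M (λ k _ → sym (*-assoc (unit M k) _ _)) ⟩
      ∑< M (λ k → unit M k * divInd d k * Φ d)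
        ≡⟨ ∑<-*ʳ M (Φ d) _ ⟩
      ∑< M (λ k → unit M k * divInd d k) * Φ d
        ≡⟨ cong₂ _*_ classSum (trans (Φ-exact d (proj₂ ∘ valid)) (cong (coeff d *_) (φ≡totient L))) ⟩
      N * η r G d * (coeff d * totient L)
        ≡⟨ rearrange N (η r G d) (coeff d) (totient L) ⟩
      N * totient L * (coeff d * η r G d)
        ≡⟨ cong (_* (coeff d * η r G d)) (sym φM≡NφL) ⟩
      totient M * (coeff d * η r G d) ∎
      where
      L : ℕ
      L = lcmFin r d
      rearrange : ∀ a b c e → a * b * (c * e) ≡ a * e * (c * b)
      rearrange = solve-∀

  -- The sum over 1 ≤ k ≤ M in Defs.LHS is unitSum (the term k = M equals the term k = 0).
  LHS-sum : ∀ m M .{{_ : NonZero M}} → (∀ i → m i ∣ M) →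
    sumℕ (map (gcdProd m) (filter (λ k → gcd k M ≟ 1) (map suc (upTo M)))) ≡ unitSum m M
  LHS-sum m M m∣M = begin
    sumℕ (map (gcdProd m) (filter (λ k → gcd k M ≟ 1) (map suc (upTo M))))
      ≡⟨ cong (λ l → sumℕ (map (gcdProd m) (filter (λ k → gcd k M ≟ 1) l))) (map-upTo suc M) ⟩
    sumℕ (map (gcdProd m) (filter (λ k → gcd k M ≟ 1) (applyUpTo suc M)))
      ≡⟨ sumℕ-filter (λ k → gcd k M ≟ 1) (gcdProd m) suc M ⟩
    ∑< M (λ k → unit M (suc k) * gcdProd m (suc k))
      ≡⟨ ∑<-shift M (λ k → unit M k * gcdProd m k) (cong₂ _*_ unit-M≡unit-0 gcdProd-M≡gcdProd-0) ⟩
    unitSum m M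
      ∎
    where
    open ≡-Reasoning
    unit-M≡unit-0 : unit M M ≡ unit M 0
    unit-M≡unit-0 = unit-cong M M 0 (trans (gcd-self M) (sym (gcd-identityˡ M)))
    gcdProd-M≡gcdProd-0 : gcdProd m M ≡ gcdProd m 0
    gcdProd-M≡gcdProd-0 = trans (sym (gcdProd-periodic m M m∣M M)) (cong (gcdProd m) (n%n≡0 M))

  LHS≡R : ∀ m M .{{_ : NonZero M}} → (∀ i → 1 ≤ m i) → lcmFin r m ∣ M → LHS r G m M ≡ toℚ (R m)
  LHS≡R m M m≥1 L∣M = begin
    LHS r G m M
      ≡⟨ cong (λ z → toℚ z ÷ℕ φ M) (LHS-sum m M (λ i → ∣-trans (lcmFin-∣ r m i) L∣M)) ⟩
    toℚ (unitSum m M) ÷ℕ φ M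
      ≡⟨ cong₂ (λ z w → toℚ z ÷ℕ w) (trans (unitSum-formula m M m≥1 L∣M) (*-comm (totient M) (R m))) (φ≡totient M) ⟩
    toℚ (R m * totient M) ÷ℕ totient M
      ≡⟨ toℚ-÷ (R m) (totient M) {{>-nonZero (totient-pos M)}} ⟩
    toℚ (R m) ∎
    where open ≡-Reasoning

  RHS≡R : ∀ m → (∀ i → 1 ≤ m i) → RHS r G m ≡ toℚ (R m)
  RHS≡R m m≥1 = trans (sumℚ-congᴬ (divTuples-valid r m) term) (toℚ-sum (λ d → coeff d * η r G d) (divTuples r m))
    where
    term : ∀ d → DivisorTuple r m d → (toℚ (Φ d) ÷ℕ φ (lcmFin r d)) ℚ.* toℚ (η r G d) ≡ toℚ (coeff d * η r G d)
    term d valid = begin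
      (toℚ (Φ d) ÷ℕ φ L) ℚ.* toℚ (η r G d)
        ≡⟨ cong (λ z → (toℚ z ÷ℕ φ L) ℚ.* toℚ (η r G d)) (Φ-exact d (proj₂ ∘ valid)) ⟩
      (toℚ (coeff d * φ L) ÷ℕ φ L) ℚ.* toℚ (η r G d)
        ≡⟨ cong (ℚ._* toℚ (η r G d)) (toℚ-÷ (coeff d) (φ L) {{φ-nonZero L {{lcmFin-nonZero r d (proj₂ ∘ valid)}}}}) ⟩
      toℚ (coeff d) ℚ.* toℚ (η r G d)
        ≡⟨ sym (toℚ-* (coeff d) (η r G d)) ⟩
      toℚ (coeff d * η r G d) ∎
      where
      open ≡-Reasoning
      L : ℕ
      L = lcmFin r d

  -- R m ≥ 1: every summand of unitSum is ≥ 1, so φ(M) ≤ unitSum m M = φ(M) · R m.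
  R-pos : ∀ m → (∀ i → 1 ≤ m i) → 1 ≤ R m
  R-pos m m≥1 = *-cancelˡ-≤ (totient M) {{>-nonZero (totient-pos M)}} (begin
    totient M * 1
      ≡⟨ *-identityʳ (totient M) ⟩
    totient M
      ≤⟨ ∑<-mono M (unit M) _ (λ k _ → termBound k) ⟩
    unitSum m M
      ≡⟨ unitSum-formula m M m≥1 ∣-refl ⟩
    totient M * R m ∎)
    where
    open ≤-Reasoning
    M : ℕ
    M = lcmFin r m
    instance
      M≢0 : NonZero M
      M≢0 = lcmFin-nonZero r m m≥1
    gcdProd-pos : ∀ k → 1 ≤ gcdProd m k
    gcdProd-pos k = prodFin-pos r _ (λ i →
      n≢0⇒n>0 (gcd[m,n]≢0 (value i k) (m i) (inj₂ (≢-nonZero⁻¹ (m i) {{>-nonZero (m≥1 i)}}))))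
    termBound : ∀ k → unit M k ≤ unit M k * gcdProd m k
    termBound k = ≤-trans (≤-reflexive (sym (*-identityʳ (unit M k)))) (*-monoʳ-≤ (unit M k) (gcdProd-pos k))

  -- Multiplicativity: for gcd(∏ m, ∏ n) = 1, with A = lcm m and B = lcm n coprime,
  -- the sum over units modulo A·B factors by the CRT, since both the unit
  -- indicator and gcdProd are multiplicative.
  R-multiplicative : ∀ m n → (∀ i → 1 ≤ m i) → (∀ i → 1 ≤ n i) → gcd (prodFin r m) (prodFin r n) ≡ 1 →
    R (λ i → m i * n i) ≡ R m * R n
  R-multiplicative m n m≥1 n≥1 m⊥n = *-cancelˡ-≡ _ _ (totient A * totient B) {{φAφB≢0}} (begin
    totient A * totient B * R mn      ≡⟨ cong (_* R mn) (sym (totient-multiplicative A B A⊥B)) ⟩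
    totient (A * B) * R mn            ≡⟨ sym (unitSum-formula mn (A * B) mn≥1 lcm[mn]∣AB) ⟩
    unitSum mn (A * B)                ≡⟨ ∑<-cong (A * B) (λ k _ → splitTerm k) ⟩
    ∑< (A * B) (λ k → (unit A k * gcdProd m k) * (unit B k * gcdProd n k))
      ≡⟨ ∑<-crt A B A⊥B _ _ (unitTerm-periodic m A (lcmFin-∣ r m)) (unitTerm-periodic n B (lcmFin-∣ r n)) ⟩
    unitSum m A * unitSum n B         ≡⟨ cong₂ _*_ (unitSum-formula m A m≥1 ∣-refl) (unitSum-formula n B n≥1 ∣-refl) ⟩
    totient A * R m * (totient B * R n) ≡⟨ *-interchange (totient A) (R m) (totient B) (R n) ⟩
    totient A * totient B * (R m * R n) ∎)
    where
    open ≡-Reasoning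
    mn : Fin r → ℕ
    mn i = m i * n i
    mn≥1 : ∀ i → 1 ≤ mn i
    mn≥1 i = *-mono-≤ (m≥1 i) (n≥1 i)
    A : ℕ
    A = lcmFin r m
    B : ℕ
    B = lcmFin r n
    instance
      A≢0 : NonZero A
      A≢0 = lcmFin-nonZero r m m≥1
      B≢0 : NonZero B
      B≢0 = lcmFin-nonZero r n n≥1
      AB≢0 : NonZero (A * B)
      AB≢0 = m*n≢0 A B
    φAφB≢0 : NonZero (totient A * totient B)
    φAφB≢0 = >-nonZero (*-mono-≤ (totient-pos A) (totient-pos B))
    A⊥B : gcd A B ≡ 1
    A⊥B = coprime-∣∣ (lcmFin-∣-prodFin r m) (lcmFin-∣-prodFin r n) m⊥n
    lcm[mn]∣AB : lcmFin r mn ∣ A * B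
    lcm[mn]∣AB = lcmFin-least r mn (λ i → *-pres-∣ (lcmFin-∣ r m i) (lcmFin-∣ r n i))
    gcdProd-* : ∀ k → gcdProd mn k ≡ gcdProd m k * gcdProd n k
    gcdProd-* k = trans (prodFin-cong r _ _ (λ i → gcd-multiplicative (value i k) (m i) (n i)
                          (coprime-∣∣ (prodFin-∣ r m i) (prodFin-∣ r n i) m⊥n)))
                        (prodFin-* r _ _)
    splitTerm : ∀ k → unit (A * B) k * gcdProd mn k ≡ (unit A k * gcdProd m k) * (unit B k * gcdProd n k)
    splitTerm k rewrite unit-* A B k | gcdProd-* k = *-interchange (unit A k) (unit B k) (gcdProd m k) (gcdProd n k)
    unitTerm-periodic : ∀ m′ M .{{_ : NonZero M}} → (∀ i → m′ i ∣ M) → Periodic M (λ k → unit M k * gcdProd m′ k)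
    unitTerm-periodic m′ M m′∣M k = cong₂ _*_ (unit-% M k) (gcdProd-periodic m′ M m′∣M k)

corollary6 : (r : ℕ) (G : Fin r → Poly) →
    ((m : Fin r → ℕ) (M : ℕ) → Positive r m → 1 ≤ M → lcmFin r m ∣ M →
      LHS r G m M ≡ RHS r G m)
    × ((m : Fin r → ℕ) → Positive r m → ∃ λ n → 1 ≤ n × RHS r G m ≡ toℚ n)
    × Multiplicative r (RHS r G)
corollary6 r G = identity , integral , (ones , (λ _ → s≤s z≤n) , RHS[ones]≢0) , multiplicative
  where
  open Main r G
  identity : (m : Fin r → ℕ) (M : ℕ) → Positive r m → 1 ≤ M → lcmFin r m ∣ M → LHS r G m M ≡ RHS r G m
  identity m M m≥1 M≥1 L∣M = trans (LHS≡R m M {{>-nonZero M≥1}} m≥1 L∣M) (sym (RHS≡R m m≥1))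
  integral : (m : Fin r → ℕ) → Positive r m → ∃ λ n → 1 ≤ n × RHS r G m ≡ toℚ n
  integral m m≥1 = R m , R-pos m m≥1 , RHS≡R m m≥1
  ones : Fin r → ℕ
  ones _ = 1
  RHS[ones]≢0 : ¬ (RHS r G ones ≡ 0ℚ)
  RHS[ones]≢0 RHS≡0 = <⇒≱ (R-pos ones (λ _ → s≤s z≤n))
    (≤-reflexive (toℚ-≡0 (R ones) (trans (sym (RHS≡R ones (λ _ → s≤s z≤n))) RHS≡0)))
  multiplicative : ∀ m n → Positive r m → Positive r n → Coprime (prodFin r m) (prodFin r n) →
    RHS r G (λ i → m i * n i) ≡ RHS r G m ℚ.* RHS r G n
  multiplicative m n m≥1 n≥1 m⊥n = begin
    RHS r G (λ i → m i * n i)      ≡⟨ RHS≡R _ (λ i → *-mono-≤ (m≥1 i) (n≥1 i)) ⟩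
    toℚ (R (λ i → m i * n i))      ≡⟨ cong toℚ (R-multiplicative m n m≥1 n≥1 (coprime⇒gcd≡1 m⊥n)) ⟩
    toℚ (R m * R n)                ≡⟨ toℚ-* (R m) (R n) ⟩
    toℚ (R m) ℚ.* toℚ (R n)        ≡⟨ sym (cong₂ ℚ._*_ (RHS≡R m m≥1) (RHS≡R n n≥1)) ⟩
    RHS r G m ℚ.* RHS r G n        ∎
    where open ≡-Reasoning
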